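{- Let $r,s$ be coprime positive integers, $c$ a positive integer, $x=\frac rs$, and $k=rsk_1$ with $k_1$ a positive integer divisible by $c$. Let $\lambda$ be a partition with $\lambda<_{r,s,c}\lambda_{r,s,k}$. Then $$\operatorname{crit}_{x,c}^+(\lambda)+\operatorname{crit}_{x,c}^-(\lambda)= \sum_{\substack{(v,[j])\in V(M_{r,s,c}(\lambda)) \\ v\leq k}} \operatorname{E}_{\operatorname{in}}(v,[j])\,\operatorname{S}_{\operatorname{in}}(v,[j])-\left\lfloor\frac{k_1(s+r)}{\operatorname{lcm}(c,s+r)}\right\rfloor,$$ where $\operatorname{E}_{\operatorname{in}}(v,[j])$ (resp. $\operatorname{S}_{\operatorname{in}}(v,[j])$) is the number of east (resp. south) edges of $M_{r,s,c}(\lambda)$ with target $(v,[j])$.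
   Context: For a box $\square$ of a Young diagram (unit squares $[i,i+1]\times[j,j+1]$, $0\le i<\lambda_{j+1}$), $a(\square)$, $l(\square)$ are the numbers of boxes strictly right in its row and strictly above in its column, $h(\square)=a(\square)+l(\square)+1$; $\operatorname{crit}^+_{x,c}(\lambda)$ counts boxes with $c\mid h(\square)$ and $\frac{a(\square)}{l(\square)+1}=x$, $\operatorname{crit}^-_{x,c}(\lambda)$ counts boxes with $c\mid h(\square)$ and $\frac{a(\square)+1}{l(\square)}=x$. For a partition $\lambda$ (with $\lambda_i=0$ beyond its length $\ell$), the boundary graph $b(\lambda)$ has, for integers $x,y\ge0$, a south edge $(x,y+1)\to(x,y)$ if either $x=0$ and $y\ge\ell$, or $x>0$ and $\lambda_{y+1}=x$, and an east edge $(x,y)\to(x+1,y)$ if either $y=0$ and $x\ge\lambda_1$, or $y>0$ and $\lambda_{y+1}\le x<\lambda_y$. $M_{r,s,c}(\lambda)$ is obtained from $b(\lambda)$ by identifying $(x_1,y_1),(x_2,y_2)$ whenever $sx_1+ry_1=sx_2+ry_2$ and $x_1-y_1\equiv x_2-y_2\pmod c$; the class of $(x,y)$ is written $(v,[j])$ with $v=sx+ry$ and $[j]=x-y \bmod c$; edges keep their South/East labels. $\lambda_{r,s,k}$ is the partition whose diagram consists of all boxes with top right corner $(x,y)$ satisfying $sx+ry\le k$. On $\mathbb N^2$, $(x_1,y_1)<_{r,s,c}(x_2,y_2)$ if either $sx_1+ry_1<sx_2+ry_2$, or $sx_1+ry_1=sx_2+ry_2$, $x_1-y_1\equiv x_2-y_2\pmod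 c$ and $x_1-y_1<x_2-y_2$; a successor of a partition is obtained by adding a box whose bottom left corner is $<_{r,s,c}$-minimal among bottom left corners of addable boxes; $\lambda<_{r,s,c}\mu$ means $\mu$ is reached from $\lambda$ by a finite nonempty chain of successors. -}

module Defs where

open import Data.Bool using (Bool; true; false; if_then_else_; _∧_; _∨_)
open import Data.Nat using (ℕ; zero; suc; _+_; _*_; _∸_; _<_; _≤_; _/_; NonZero; _≡ᵇ_; _<ᵇ_; _≤ᵇ_; pred)
open import Data.Nat.Divisibility using (_∣?_)
open import Data.Integer using (ℤ; +_; _-_; _%ℕ_) renaming (_<_ to _<ℤ_)
open import Data.List using (List; []; _∷_; length; map; upTo; filterᵇ)
open import Data.Product using (Σ; _×_; _,_)
open import Data.Sum using (_⊎_)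
open import Relation.Nullary using (¬_; does)
open import Relation.Binary.PropositionalEquality using (_≡_)
open import Relation.Binary.Construct.Closure.Transitive using (TransClosure)

-- Partitions: weakly decreasing lists of positive naturals.
-- row la j = λ_{j+1}  (0-indexed rows, 0 beyond the length).

data IsPartition : List ℕ → Set where
  nil  : IsPartition []
  one  : ∀ {a} → 0 < a → IsPartition (a ∷ [])
  cons : ∀ {a b l} → b ≤ a → IsPartition (b ∷ l) → IsPartition (a ∷ b ∷ l)

row : List ℕ → ℕ → ℕ
row []      _       = 0
row (a ∷ l) zero    = a
row (a ∷ l) (suc j) = row l j

sumBelow : ℕ → (ℕ → ℕ) → ℕ
sumBelow zero    f = 0
sumBelow (suc n) f = sumBelow n f + f n

countBelow : ℕ → (ℕ → Bool) → ℕ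
countBelow n p = sumBelow n (λ i → if p i then 1 else 0)

-- arm, leg, hook of the box [i,i+1]×[j,j+1]  (i < row la j, j < length la)

arm : List ℕ → ℕ → ℕ → ℕ
arm la i j = row la j ∸ suc i

leg : List ℕ → ℕ → ℕ → ℕ
leg la i j = countBelow (length la) (λ j' → (j <ᵇ j') ∧ (i <ᵇ row la j'))

hook : List ℕ → ℕ → ℕ → ℕ
hook la i j = arm la i j + leg la i j + 1

countBoxes : List ℕ → (ℕ → ℕ → Bool) → ℕ
countBoxes la p = sumBelow (length la) (λ j → countBelow (row la j) (λ i → p i j))

-- x = r/s :  a/(l+1) = r/s  ⇔  s a = r (l+1)
critPlus : ℕ → ℕ → ℕ → List ℕ → ℕ
critPlus r s c la = countBoxes la (λ i j →
  does (c ∣? hook la i j) ∧ (s * arm la i j ≡ᵇ r * (leg la i j + 1)))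

-- (a+1)/l = r/s  ⇔  l > 0 and s (a+1) = r l
critMinus : ℕ → ℕ → ℕ → List ℕ → ℕ
critMinus r s c la = countBoxes la (λ i j →
  does (c ∣? hook la i j) ∧ ((0 <ᵇ leg la i j) ∧ (s * (arm la i j + 1) ≡ᵇ r * leg la i j)))

-- south edge (x , y+1) → (x , y)
southEdge : List ℕ → ℕ → ℕ → Bool
southEdge la x y = ((x ≡ᵇ 0) ∧ (length la ≤ᵇ y)) ∨ ((0 <ᵇ x) ∧ (row la y ≡ᵇ x))

-- east edge (x , y) → (x+1 , y)
eastEdge : List ℕ → ℕ → ℕ → Bool
eastEdge la x y = ((y ≡ᵇ 0) ∧ (row la 0 ≤ᵇ x))
                ∨ ((0 <ᵇ y) ∧ ((row la y ≤ᵇ x) ∧ (x <ᵇ row la (pred y))))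

-- the quotient M_{r,s,c}(la): class of (x , y) is (s x + r y , (x - y) mod c)

residue : (c : ℕ) .{{_ : NonZero c}} → ℕ → ℕ → ℕ
residue c x y = ((+ x) - (+ y)) %ℕ c

inClass : (r s c : ℕ) .{{_ : NonZero c}} → ℕ → ℕ → ℕ → ℕ → Bool
inClass r s c v j x y = (s * x + r * y ≡ᵇ v) ∧ (residue c x y ≡ᵇ j)

-- (for r, s ≥ 1 every point of the class (v , [j]) has x, y ≤ v)
-- number of east edges of M with target (v , [j])
Ein : (r s c : ℕ) .{{_ : NonZero c}} → List ℕ → ℕ → ℕ → ℕ
Ein r s c la v j = sumBelow (suc v) (λ x → countBelow (suc v) (λ y →
  eastEdge la x y ∧ inClass r s c v j (suc x) y))

Sin : (r s c : ℕ) .{{_ : NonZero c}} → List ℕ → ℕ → ℕ → ℕ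
Sin r s c la v j = sumBelow (suc v) (λ x → countBelow (suc v) (λ y →
  southEdge la x y ∧ inClass r s c v j x y))

isVertex : (r s c : ℕ) .{{_ : NonZero c}} → ℕ → ℕ → Bool
isVertex r s c v j = 0 <ᵇ sumBelow (suc v) (λ x → countBelow (suc v) (λ y → inClass r s c v j x y))

edgeSum : (r s c : ℕ) .{{_ : NonZero c}} → List ℕ → ℕ → ℕ
edgeSum r s c la k = sumBelow (suc k) (λ v → sumBelow c (λ j →
  if isVertex r s c v j then Ein r s c la v j * Sin r s c la v j else 0))

rowRSK : ℕ → ℕ → ℕ → ℕ → ℕ
rowRSK r s k j = countBelow k (λ i → s * suc i + r * suc j ≤ᵇ k)

lambdaRSK : ℕ → ℕ → ℕ → List ℕ
lambdaRSK r s k = filterᵇ (λ a → 0 <ᵇ a) (map (rowRSK r s k) (upTo k))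

Pt : Set
Pt = ℕ × ℕ

ltRSC : (r s c : ℕ) .{{_ : NonZero c}} → Pt → Pt → Set
ltRSC r s c (x₁ , y₁) (x₂ , y₂) =
  (s * x₁ + r * y₁ < s * x₂ + r * y₂)
  ⊎ ((s * x₁ + r * y₁ ≡ s * x₂ + r * y₂)
     × (residue c x₁ y₁ ≡ residue c x₂ y₂)
     × ((+ x₁) - (+ y₁) <ℤ (+ x₂) - (+ y₂)))

Addable : List ℕ → ℕ → Set
Addable la j = (j ≡ 0) ⊎ (row la j < row la (pred j))

corner : List ℕ → ℕ → Pt
corner la j = (row la j , j)

addBox : List ℕ → ℕ → List ℕ
addBox []      zero    = 1 ∷ []
addBox []      (suc j) = 0 ∷ addBox [] j
addBox (a ∷ l) zero    = suc a ∷ l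
addBox (a ∷ l) (suc j) = a ∷ addBox l j

Successor : (r s c : ℕ) .{{_ : NonZero c}} → List ℕ → List ℕ → Set
Successor r s c la mu =
  Σ ℕ λ j → Addable la j
          × (∀ j' → Addable la j' → ¬ ltRSC r s c (corner la j') (corner la j))
          × (mu ≡ addBox la j)

PartLt : (r s c : ℕ) .{{_ : NonZero c}} → List ℕ → List ℕ → Set
PartLt r s c = TransClosure (Successor r s c)

floorDiv : ℕ → ℕ → ℕ
floorDiv n zero    = 0
floorDiv n (suc d) = n / suc d

{-# OPTIONS --safe #-}
-- A south edge and an east edge of b(λ) contribute to E_in · S_in at the same vertex of M
-- exactly when their targets, (λ_{y+1}, y) for the south edge of row y and (a + 1, λ'_{a+1})
-- for the east edge of column a, have equal values s x + r y (at most k) and equal residues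
-- of x - y mod c.  If the cell (a, y) lies in λ this says s · arm = r · (leg + 1) and
-- c ∣ hook: these pairs are the crit⁺ boxes.  If it lies outside, coprimality of r and s
-- forces (a + 1 - λ_{y+1}, y - λ'_{a+1}) = t (r, s) with 1 ≤ t ≤ k₁, and the residue
-- condition becomes c ∣ (s + r) t.  For each t, such outer pairs outnumber the boxes with
-- (arm + 1, leg) = t (r, s) by exactly one (peel off the first row), and those boxes are the
-- crit⁻ boxes belonging to t.  There are ⌊k₁ (s + r) / lcm(c, s + r)⌋ admissible t.
module Submission where

open import Defs
open import Data.Bool using (Bool; true; false; if_then_else_; _∧_; not; T)
open import Data.Bool.Properties using (T-≡; ∨-identityʳ)
open import Data.Empty using (⊥; ⊥-elim)
open import Data.List using (List; []; _∷_; length; map; filter; applyUpTo)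
open import Data.Nat
open import Data.Nat.Properties
open import Algebra.Properties.CommutativeSemigroup +-commutativeSemigroup using (interchange)
open import Data.Nat.DivMod using (m≡m%n+[m/n]*n; m%n<n; m/n*n≡m; m*n/o*n≡m/o; /-congʳ)
open import Data.Nat.Divisibility
open import Data.Nat.Coprimality using (Coprime; coprime-divisor)
open import Data.Nat.GCD using (gcd)
open import Data.Nat.LCM using (lcm; lcm-least; m∣lcm[m,n]; n∣lcm[m,n]; gcd*lcm)
open import Data.Nat.Tactic.RingSolver using (solve-∀)
open import Data.Product using (Σ; ∃-syntax; _×_; _,_; proj₁; proj₂)
open import Data.Unit using (tt)
open import Function using (_∘_; _⇔_; mk⇔; Equivalence)
open import Relation.Nullary using (¬_; yes; no; does)
open import Relation.Unary using (Pred; Decidable)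
open import Relation.Binary using (tri<; tri≈; tri>)
open import Relation.Binary.Construct.Closure.Transitive using ([_]; _∷_)
open import Relation.Binary.PropositionalEquality

⟦_⟧ : Bool → ℕ
⟦ b ⟧ = if b then 1 else 0

∧-intro : ∀ {a b} → T a → T b → T (a ∧ b)
∧-intro {true} {true} _ _ = tt

∧-elimˡ : ∀ {a b} → T (a ∧ b) → T a
∧-elimˡ {true} _ = tt

∧-elimʳ : ∀ {a b} → T (a ∧ b) → T b
∧-elimʳ {true} t = t

not-intro : ∀ {b} → ¬ T b → T (not b)
not-intro {false} _ = tt
not-intro {true} ¬t = ¬t tt

not-elim : ∀ {b} → T (not b) → ¬ T b
not-elim {false} _ ()

T-⇔⇒≡ : ∀ {a b} → T a ⇔ T b → a ≡ b
T-⇔⇒≡ {false} {false} _ = refl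
T-⇔⇒≡ {false} {true} a⇔b = ⊥-elim (Equivalence.from a⇔b tt)
T-⇔⇒≡ {true} {false} a⇔b = ⊥-elim (Equivalence.to a⇔b tt)
T-⇔⇒≡ {true} {true} _ = refl

⟦⟧-true : ∀ {b} → T b → ⟦ b ⟧ ≡ 1
⟦⟧-true {true} _ = refl

⟦⟧-false : ∀ {b} → ¬ T b → ⟦ b ⟧ ≡ 0
⟦⟧-false {false} _ = refl
⟦⟧-false {true} ¬t = ⊥-elim (¬t tt)

⟦⟧-≤ : ∀ {a b} → (T a → T b) → ⟦ a ⟧ ≤ ⟦ b ⟧
⟦⟧-≤ {false} _ = z≤n
⟦⟧-≤ {true} a⇒b rewrite ⟦⟧-true (a⇒b tt) = ≤-refl

⟦∧⟧ : ∀ a b → ⟦ a ∧ b ⟧ ≡ ⟦ a ⟧ * ⟦ b ⟧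
⟦∧⟧ false b = refl
⟦∧⟧ true b = sym (*-identityˡ ⟦ b ⟧)

⟦⟧-split : ∀ c b → ⟦ b ⟧ ≡ ⟦ c ∧ b ⟧ + ⟦ not c ∧ b ⟧
⟦⟧-split false b = refl
⟦⟧-split true b = sym (+-identityʳ ⟦ b ⟧)

from-≡ᵇ : ∀ {m n} → T (m ≡ᵇ n) → m ≡ n
from-≡ᵇ {m} {n} = ≡ᵇ⇒≡ m n

to-≡ᵇ : ∀ {m n} → m ≡ n → T (m ≡ᵇ n)
to-≡ᵇ {m} {n} = ≡⇒≡ᵇ m n

from-<ᵇ : ∀ {m n} → T (m <ᵇ n) → m < n
from-<ᵇ {m} {n} = <ᵇ⇒< m n

from-≤ᵇ : ∀ {m n} → T (m ≤ᵇ n) → m ≤ n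
from-≤ᵇ {m} {n} = ≤ᵇ⇒≤ m n

∧-congˡ : ∀ {c a b} → (T c → T a ⇔ T b) → T (c ∧ a) ⇔ T (c ∧ b)
∧-congˡ {false} _ = mk⇔ (λ ()) (λ ())
∧-congˡ {true} a⇔b = a⇔b _

≡ᵇ-⇔ : ∀ {m n m' n'} → (m ≡ n → m' ≡ n') → (m' ≡ n' → m ≡ n) → T (m ≡ᵇ n) ⇔ T (m' ≡ᵇ n')
≡ᵇ-⇔ to from = mk⇔ (to-≡ᵇ ∘ to ∘ from-≡ᵇ) (to-≡ᵇ ∘ from ∘ from-≡ᵇ)

from-∣? : ∀ {m n} → T (does (m ∣? n)) → m ∣ n
from-∣? {m} {n} t with m ∣? n
... | yes m∣n = m∣n

to-∣? : ∀ {m n} → m ∣ n → T (does (m ∣? n))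
to-∣? {m} {n} m∣n with m ∣? n
... | yes _ = _
... | no m∤n = m∤n m∣n


pred[n]<n : ∀ {n} → 0 < n → pred n < n
pred[n]<n {suc n} _ = ≤-refl

*-pos : ∀ {m n} → 0 < m → 0 < n → 0 < m * n
*-pos {m} {n} 0<m 0<n = >-nonZero⁻¹ (m * n) {{m*n≢0 m n {{>-nonZero 0<m}} {{>-nonZero 0<n}}}}

sumBelow-cong : ∀ n {f g : ℕ → ℕ} → (∀ i → i < n → f i ≡ g i) → sumBelow n f ≡ sumBelow n g
sumBelow-cong zero f≗g = refl
sumBelow-cong (suc n) f≗g = cong₂ _+_ (sumBelow-cong n (λ i i<n → f≗g i (m<n⇒m<1+n i<n))) (f≗g n ≤-refl)

sumBelow-mono : ∀ n {f g : ℕ → ℕ} → (∀ i → i < n → f i ≤ g i) → sumBelow n f ≤ sumBelow n g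
sumBelow-mono zero f≤g = z≤n
sumBelow-mono (suc n) f≤g = +-mono-≤ (sumBelow-mono n (λ i i<n → f≤g i (m<n⇒m<1+n i<n))) (f≤g n ≤-refl)

sumBelow-zero : ∀ n {f : ℕ → ℕ} → (∀ i → i < n → f i ≡ 0) → sumBelow n f ≡ 0
sumBelow-zero n {f} f≗0 = trans (sumBelow-cong n f≗0) (zeros n)
  where
  zeros : ∀ n → sumBelow n (λ _ → 0) ≡ 0
  zeros zero = refl
  zeros (suc n) = cong (_+ 0) (zeros n)

sumBelow-+ : ∀ n (f g : ℕ → ℕ) → sumBelow n (λ i → f i + g i) ≡ sumBelow n f + sumBelow n g
sumBelow-+ zero f g = refl
sumBelow-+ (suc n) f g =
  trans (cong (_+ (f n + g n)) (sumBelow-+ n f g)) (interchange (sumBelow n f) (sumBelow n g) (f n) (g n))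

sumBelow-swap : ∀ n m (f : ℕ → ℕ → ℕ) →
  sumBelow n (λ i → sumBelow m (f i)) ≡ sumBelow m (λ j → sumBelow n (λ i → f i j))
sumBelow-swap zero m f = sym (sumBelow-zero m (λ _ _ → refl))
sumBelow-swap (suc n) m f =
  trans (cong (_+ sumBelow m (f n)) (sumBelow-swap n m f)) (sym (sumBelow-+ m _ (f n)))

*-sumBelow : ∀ n a (f : ℕ → ℕ) → a * sumBelow n f ≡ sumBelow n (λ i → a * f i)
*-sumBelow zero a f = *-zeroʳ a
*-sumBelow (suc n) a f = trans (*-distribˡ-+ a (sumBelow n f) (f n)) (cong (_+ a * f n) (*-sumBelow n a f))

sumBelow-*-sumBelow : ∀ n m (f g : ℕ → ℕ) →
  sumBelow n f * sumBelow m g ≡ sumBelow n (λ i → sumBelow m (λ j → f i * g j))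
sumBelow-*-sumBelow n m f g = begin
  sumBelow n f * sumBelow m g          ≡⟨ *-comm (sumBelow n f) (sumBelow m g) ⟩
  sumBelow m g * sumBelow n f          ≡⟨ *-sumBelow n (sumBelow m g) f ⟩
  sumBelow n (λ i → sumBelow m g * f i) ≡⟨ sumBelow-cong n (λ i _ → *-comm (sumBelow m g) (f i)) ⟩
  sumBelow n (λ i → f i * sumBelow m g) ≡⟨ sumBelow-cong n (λ i _ → *-sumBelow m (f i) g) ⟩
  sumBelow n (λ i → sumBelow m (λ j → f i * g j)) ∎
  where open ≡-Reasoning

sumBelow-suc : ∀ n (f : ℕ → ℕ) → sumBelow (suc n) f ≡ f 0 + sumBelow n (λ i → f (suc i))
sumBelow-suc zero f = +-comm 0 (f 0)
sumBelow-suc (suc n) f =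
  trans (cong (_+ f (suc n)) (sumBelow-suc n f)) (+-assoc (f 0) (sumBelow n (λ i → f (suc i))) (f (suc n)))

sumBelow-pad : ∀ m n (f : ℕ → ℕ) → m ≤ n → (∀ i → m ≤ i → i < n → f i ≡ 0) →
  sumBelow n f ≡ sumBelow m f
sumBelow-pad m zero f z≤n _ = refl
sumBelow-pad m (suc n) f m≤1+n f≗0 with m ≟ suc n
... | yes refl = refl
... | no m≢1+n = begin
  sumBelow n f + f n ≡⟨ cong₂ _+_ (sumBelow-pad m n f m≤n (λ i m≤i i<n → f≗0 i m≤i (m<n⇒m<1+n i<n)))
                                  (f≗0 n m≤n ≤-refl) ⟩
  sumBelow m f + 0   ≡⟨ +-identityʳ (sumBelow m f) ⟩
  sumBelow m f       ∎
  where
  open ≡-Reasoning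
  m≤n : m ≤ n
  m≤n = ≤-pred (≤∧≢⇒< m≤1+n m≢1+n)

sumBelow-single : ∀ n (f : ℕ → ℕ) e → e < n → (∀ i → i < n → i ≢ e → f i ≡ 0) → sumBelow n f ≡ f e
sumBelow-single (suc n) f e e<1+n f≗0 with e ≟ n
... | yes refl = cong (_+ f e) (sumBelow-zero e (λ i i<e → f≗0 i (m<n⇒m<1+n i<e) (<⇒≢ i<e)))
... | no e≢n = begin
  sumBelow n f + f n ≡⟨ cong₂ _+_ (sumBelow-single n f e (≤∧≢⇒< (≤-pred e<1+n) e≢n) (λ i i<n → f≗0 i (m<n⇒m<1+n i<n)))
                                  (f≗0 n ≤-refl (e≢n ∘ sym)) ⟩
  f e + 0            ≡⟨ +-identityʳ (f e) ⟩
  f e                ∎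
  where open ≡-Reasoning

countBelow-cong : ∀ n {p q : ℕ → Bool} → (∀ i → i < n → T (p i) ⇔ T (q i)) → countBelow n p ≡ countBelow n q
countBelow-cong n p⇔q = sumBelow-cong n (λ i i<n → cong ⟦_⟧ (T-⇔⇒≡ (p⇔q i i<n)))

countBelow-none : ∀ n {p : ℕ → Bool} → (∀ i → i < n → ¬ T (p i)) → countBelow n p ≡ 0
countBelow-none n ¬p = sumBelow-zero n (λ i i<n → ⟦⟧-false (¬p i i<n))

countBelow-all : ∀ n {p : ℕ → Bool} → (∀ i → i < n → T (p i)) → countBelow n p ≡ n
countBelow-all zero p = refl
countBelow-all (suc n) p =
  trans (cong₂ _+_ (countBelow-all n (λ i i<n → p i (m<n⇒m<1+n i<n))) (⟦⟧-true (p n ≤-refl))) (+-comm n 1)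

countBelow-unique : ∀ n (p : ℕ → Bool) e → e < n → T (p e) → (∀ i → i < n → T (p i) → i ≡ e) →
  countBelow n p ≡ 1
countBelow-unique n p e e<n pe unique =
  trans (sumBelow-single n _ e e<n (λ i i<n i≢e → ⟦⟧-false (λ pi → i≢e (unique i i<n pi)))) (⟦⟧-true pe)

countBelow-pad : ∀ m n (p : ℕ → Bool) → m ≤ n → (∀ i → m ≤ i → i < n → ¬ T (p i)) →
  countBelow n p ≡ countBelow m p
countBelow-pad m n p m≤n ¬p = sumBelow-pad m n _ m≤n (λ i m≤i i<n → ⟦⟧-false (¬p i m≤i i<n))

countBelow-∧ˡ : ∀ n b (p : ℕ → Bool) → countBelow n (λ i → b ∧ p i) ≡ ⟦ b ⟧ * countBelow n p
countBelow-∧ˡ n false p = countBelow-none n (λ _ _ ())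
countBelow-∧ˡ n true p = sym (+-identityʳ _)

countBelow-at : ∀ n e (q : ℕ → Bool) → countBelow n (λ i → (i ≡ᵇ e) ∧ q i) ≡ ⟦ (e <ᵇ n) ∧ q e ⟧
countBelow-at n e q with e <? n
... | no e≮n = trans (countBelow-none n (λ i i<n t → e≮n (subst (_< n) (from-≡ᵇ (∧-elimˡ t)) i<n)))
                     (sym (⟦⟧-false (e≮n ∘ from-<ᵇ ∘ ∧-elimˡ)))
... | yes e<n rewrite Equivalence.to T-≡ (<⇒<ᵇ e<n) with q e in qe
...   | true = countBelow-unique n _ e e<n (∧-intro (to-≡ᵇ {e} refl) (subst T (sym qe) tt))
                 (λ i _ t → from-≡ᵇ (∧-elimˡ t))
...   | false = countBelow-none n (λ i _ t → subst T qe (subst (T ∘ q) (from-≡ᵇ (∧-elimˡ t)) (∧-elimʳ {i ≡ᵇ e} t)))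

countBelow-at-< : ∀ n e (q : ℕ → Bool) → (T (q e) → e < n) → countBelow n (λ i → (i ≡ᵇ e) ∧ q i) ≡ ⟦ q e ⟧
countBelow-at-< n e q qe⇒e<n = trans (countBelow-at n e q)
  (cong ⟦_⟧ (T-⇔⇒≡ (mk⇔ ∧-elimʳ (λ qe → ∧-intro (<⇒<ᵇ (qe⇒e<n qe)) qe))))

sameClass⇔ : ∀ {v j V₁ ρ₁ V₂ ρ₂} →
  T (((V₁ ≡ᵇ v) ∧ (ρ₁ ≡ᵇ j)) ∧ ((V₂ ≡ᵇ v) ∧ (ρ₂ ≡ᵇ j))) ⇔
  T ((j ≡ᵇ ρ₁) ∧ ((v ≡ᵇ V₁) ∧ ((V₁ ≡ᵇ V₂) ∧ (ρ₁ ≡ᵇ ρ₂))))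
sameClass⇔ {v} {j} {V₁} {ρ₁} {V₂} {ρ₂} = mk⇔ to from
  where
  to : T (((V₁ ≡ᵇ v) ∧ (ρ₁ ≡ᵇ j)) ∧ ((V₂ ≡ᵇ v) ∧ (ρ₂ ≡ᵇ j))) →
       T ((j ≡ᵇ ρ₁) ∧ ((v ≡ᵇ V₁) ∧ ((V₁ ≡ᵇ V₂) ∧ (ρ₁ ≡ᵇ ρ₂))))
  to t = ∧-intro (to-≡ᵇ (sym ρ₁≡j)) (∧-intro (to-≡ᵇ (sym V₁≡v))
           (∧-intro (to-≡ᵇ (trans V₁≡v (sym V₂≡v))) (to-≡ᵇ (trans ρ₁≡j (sym ρ₂≡j)))))
    where
    t₁ : T ((V₁ ≡ᵇ v) ∧ (ρ₁ ≡ᵇ j))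
    t₁ = ∧-elimˡ t
    t₂ : T ((V₂ ≡ᵇ v) ∧ (ρ₂ ≡ᵇ j))
    t₂ = ∧-elimʳ {(V₁ ≡ᵇ v) ∧ (ρ₁ ≡ᵇ j)} t
    V₁≡v : V₁ ≡ v
    V₁≡v = from-≡ᵇ (∧-elimˡ t₁)
    ρ₁≡j : ρ₁ ≡ j
    ρ₁≡j = from-≡ᵇ (∧-elimʳ {V₁ ≡ᵇ v} t₁)
    V₂≡v : V₂ ≡ v
    V₂≡v = from-≡ᵇ (∧-elimˡ t₂)
    ρ₂≡j : ρ₂ ≡ j
    ρ₂≡j = from-≡ᵇ (∧-elimʳ {V₂ ≡ᵇ v} t₂)
  from : T ((j ≡ᵇ ρ₁) ∧ ((v ≡ᵇ V₁) ∧ ((V₁ ≡ᵇ V₂) ∧ (ρ₁ ≡ᵇ ρ₂)))) →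
         T (((V₁ ≡ᵇ v) ∧ (ρ₁ ≡ᵇ j)) ∧ ((V₂ ≡ᵇ v) ∧ (ρ₂ ≡ᵇ j)))
  from t = ∧-intro (∧-intro (to-≡ᵇ (sym v≡V₁)) (to-≡ᵇ (sym j≡ρ₁)))
                   (∧-intro (to-≡ᵇ (trans (sym V₁≡V₂) (sym v≡V₁))) (to-≡ᵇ (trans (sym ρ₁≡ρ₂) (sym j≡ρ₁))))
    where
    j≡ρ₁ : j ≡ ρ₁
    j≡ρ₁ = from-≡ᵇ (∧-elimˡ t)
    t' : T ((v ≡ᵇ V₁) ∧ ((V₁ ≡ᵇ V₂) ∧ (ρ₁ ≡ᵇ ρ₂)))
    t' = ∧-elimʳ {j ≡ᵇ ρ₁} t
    v≡V₁ : v ≡ V₁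
    v≡V₁ = from-≡ᵇ (∧-elimˡ t')
    t'' : T ((V₁ ≡ᵇ V₂) ∧ (ρ₁ ≡ᵇ ρ₂))
    t'' = ∧-elimʳ {v ≡ᵇ V₁} t'
    V₁≡V₂ : V₁ ≡ V₂
    V₁≡V₂ = from-≡ᵇ (∧-elimˡ t'')
    ρ₁≡ρ₂ : ρ₁ ≡ ρ₂
    ρ₁≡ρ₂ = from-≡ᵇ (∧-elimʳ {V₁ ≡ᵇ V₂} t'')

countBelow-downClosed : ∀ n (p : ℕ → Bool) → (∀ i j → i ≤ j → T (p j) → T (p i)) →
  ∀ i → i < countBelow n p ⇔ (i < n × T (p i))
countBelow-downClosed zero p down i = mk⇔ (λ ()) (λ ())
countBelow-downClosed (suc n) p down i with p n in pn
... | true = mk⇔ (λ i<c → let i<n+1 = subst (i <_) count≡ i<c in i<n+1 , down i n (≤-pred i<n+1) (subst T (sym pn) tt))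
                 (subst (i <_) (sym count≡) ∘ proj₁)
  where
  count≡ : countBelow n p + 1 ≡ suc n
  count≡ = trans (cong (_+ 1) (countBelow-all n (λ j j<n → down j n (<⇒≤ j<n) (subst T (sym pn) tt)))) (+-comm n 1)
... | false = mk⇔ (λ i<c → let (i<n , pi) = Equivalence.to ih (subst (i <_) (+-identityʳ _) i<c) in m<n⇒m<1+n i<n , pi)
                  (λ (i<n+1 , pi) → subst (i <_) (sym (+-identityʳ _))
                     (Equivalence.from ih (≤∧≢⇒< (≤-pred i<n+1) (λ { refl → subst T pn pi }) , pi)))
  where
  ih : i < countBelow n p ⇔ (i < n × T (p i))
  ih = countBelow-downClosed n p down i

countBelow-> : ∀ n j → countBelow n (j <ᵇ_) ≡ n ∸ suc j
countBelow-> zero j = refl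
countBelow-> (suc n) j with j <? n
... | yes j<n = begin
  countBelow n (j <ᵇ_) + ⟦ j <ᵇ n ⟧ ≡⟨ cong₂ _+_ (countBelow-> n j) (⟦⟧-true (<⇒<ᵇ j<n)) ⟩
  n ∸ suc j + 1                    ≡⟨ +-comm (n ∸ suc j) 1 ⟩
  suc (n ∸ suc j)                  ≡⟨ +-∸-assoc 1 j<n ⟨
  suc n ∸ suc j                    ∎
  where open ≡-Reasoning
... | no j≮n = begin
  countBelow n (j <ᵇ_) + ⟦ j <ᵇ n ⟧ ≡⟨ cong₂ _+_ (countBelow-> n j) (⟦⟧-false (j≮n ∘ from-<ᵇ)) ⟩
  n ∸ suc j + 0                    ≡⟨ +-identityʳ (n ∸ suc j) ⟩
  n ∸ suc j                        ≡⟨ m≤n⇒m∸n≡0 (m≤n⇒m≤1+n (≮⇒≥ j≮n)) ⟩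
  0                                ≡⟨ m≤n⇒m∸n≡0 (≮⇒≥ j≮n) ⟨
  suc n ∸ suc j                    ∎
  where open ≡-Reasoning

countBelow-interval : ∀ n j h → h ≤ n → countBelow n (λ x → (j <ᵇ x) ∧ (x <ᵇ h)) ≡ h ∸ suc j
countBelow-interval n j h h≤n = begin
  countBelow n (λ x → (j <ᵇ x) ∧ (x <ᵇ h))
    ≡⟨ countBelow-pad h n _ h≤n (λ x h≤x _ t → <⇒≱ (from-<ᵇ (∧-elimʳ {j <ᵇ x} t)) h≤x) ⟩
  countBelow h (λ x → (j <ᵇ x) ∧ (x <ᵇ h)) ≡⟨ countBelow-cong h (λ x x<h → mk⇔ ∧-elimˡ (λ t → ∧-intro t (<⇒<ᵇ x<h))) ⟩
  countBelow h (j <ᵇ_)                     ≡⟨ countBelow-> h j ⟩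
  h ∸ suc j                                ∎
  where open ≡-Reasoning

countBelow-bounded-cong : ∀ m n {p q : ℕ → Bool} → (∀ i → T (p i) ⇔ T (q i)) →
  (∀ i → T (p i) → i < m) → (∀ i → T (q i) → i < n) → countBelow m p ≡ countBelow n q
countBelow-bounded-cong m n {p} {q} p⇔q p⇒<m q⇒<n = begin
  countBelow m p       ≡⟨ countBelow-pad m (m + n) p (m≤m+n m n) (λ i m≤i _ t → <⇒≱ (p⇒<m i t) m≤i) ⟨
  countBelow (m + n) p ≡⟨ countBelow-cong (m + n) (λ i _ → p⇔q i) ⟩
  countBelow (m + n) q ≡⟨ countBelow-pad n (m + n) q (m≤n+m n m) (λ i n≤i _ t → <⇒≱ (q⇒<n i t) n≤i) ⟩
  countBelow n q       ∎
  where open ≡-Reasoning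

⟦⟧≡countBelow-unique : ∀ {b} n (q : ℕ → Bool) → (T b → Σ ℕ λ t → t < n × T (q t)) →
  (∀ t → t < n → T (q t) → T b) → (∀ t t' → T (q t) → T (q t') → t ≡ t') → ⟦ b ⟧ ≡ countBelow n q
⟦⟧≡countBelow-unique {false} n q _ q⇒b _ = sym (countBelow-none n q⇒b)
⟦⟧≡countBelow-unique {true} n q witness _ unique =
  let (t , t<n , qt) = witness tt in sym (countBelow-unique n q t t<n qt (λ t' _ qt' → unique t' t qt' qt))

⟦⟧*-cong : ∀ b {m n} → (T b → m ≡ n) → ⟦ b ⟧ * m ≡ ⟦ b ⟧ * n
⟦⟧*-cong false _ = refl
⟦⟧*-cong true m≡n = cong (1 *_) (m≡n tt)

sumBelow-sumBelow-countBelow-∧ : ∀ n (m : ℕ → ℕ) K (b : ℕ → Bool) (q : ℕ → ℕ → ℕ → Bool) →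
  sumBelow n (λ a → sumBelow (m a) (λ y → countBelow K (λ t → b t ∧ q t a y)))
    ≡ sumBelow K (λ t → ⟦ b t ⟧ * sumBelow n (λ a → countBelow (m a) (q t a)))
sumBelow-sumBelow-countBelow-∧ n m K b q = begin
  sumBelow n (λ a → sumBelow (m a) (λ y → countBelow K (λ t → b t ∧ q t a y)))
    ≡⟨ sumBelow-cong n (λ a _ → sumBelow-swap (m a) K _) ⟩
  sumBelow n (λ a → sumBelow K (λ t → countBelow (m a) (λ y → b t ∧ q t a y)))
    ≡⟨ sumBelow-swap n K _ ⟩
  sumBelow K (λ t → sumBelow n (λ a → countBelow (m a) (λ y → b t ∧ q t a y)))
    ≡⟨ sumBelow-cong K (λ t _ → trans (sumBelow-cong n (λ a _ → countBelow-∧ˡ (m a) (b t) (q t a)))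
                                      (sym (*-sumBelow n ⟦ b t ⟧ _))) ⟩
  sumBelow K (λ t → ⟦ b t ⟧ * sumBelow n (λ a → countBelow (m a) (q t a))) ∎
  where open ≡-Reasoning


module Residues where

  open import Data.Integer as ℤ using (ℤ; +_; ∣_∣; _%ℕ_; _/ℕ_)
  import Data.Integer.Properties as ℤ
  open import Data.Integer.DivMod using (a≡a%ℕn+[a/ℕn]*n; n%ℕd<d)
  import Data.Integer.Tactic.RingSolver as ℤ-Solver

  private
    [a+p*c]-[a+q*c] : ∀ (a p q c : ℤ) → (a ℤ.+ p ℤ.* c) ℤ.- (a ℤ.+ q ℤ.* c) ≡ (p ℤ.- q) ℤ.* c
    [a+p*c]-[a+q*c] = ℤ-Solver.solve-∀

    [a+b+x]-[a+x] : ∀ (a b x : ℤ) → (a ℤ.+ b ℤ.+ x) ℤ.- (a ℤ.+ x) ≡ b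
    [a+b+x]-[a+x] = ℤ-Solver.solve-∀

    b≡[a+b]-a : ∀ (a b : ℤ) → b ≡ (a ℤ.+ b) ℤ.- a
    b≡[a+b]-a = ℤ-Solver.solve-∀

    [a+q*c]+m*c : ∀ (a q m c : ℤ) → a ℤ.+ (q ℤ.+ m) ℤ.* c ≡ (a ℤ.+ q ℤ.* c) ℤ.+ m ℤ.* c
    [a+q*c]+m*c = ℤ-Solver.solve-∀

    difference-shift : ∀ (x₁ y₁ x₂ y₂ h : ℤ) → x₂ ℤ.+ y₁ ≡ x₁ ℤ.+ y₂ ℤ.+ h →
      x₂ ℤ.- y₂ ≡ (x₁ ℤ.- y₁) ℤ.+ h
    difference-shift x₁ y₁ x₂ y₂ h eq =
      trans (unshift x₂ y₁ y₂) (trans (cong (λ w → w ℤ.- y₁ ℤ.- y₂) eq) (regroup x₁ y₁ y₂ h))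
      where
      unshift : ∀ x₂ y₁ y₂ → x₂ ℤ.- y₂ ≡ (x₂ ℤ.+ y₁) ℤ.- y₁ ℤ.- y₂
      unshift = ℤ-Solver.solve-∀
      regroup : ∀ x₁ y₁ y₂ h → (x₁ ℤ.+ y₂ ℤ.+ h) ℤ.- y₁ ℤ.- y₂ ≡ (x₁ ℤ.- y₁) ℤ.+ h
      regroup = ℤ-Solver.solve-∀

  module _ {c : ℕ} where

    remainder-gap : ∀ {ρ ρ' : ℕ} {q q' : ℤ} → ρ < ρ' → ρ' < c →
      + ρ ℤ.+ q ℤ.* + c ≢ + ρ' ℤ.+ q' ℤ.* + c
    remainder-gap {ρ} {ρ'} {q} {q'} ρ<ρ' ρ'<c eq =
      <⇒≱ (≤-<-trans (m∸n≤m ρ' ρ) ρ'<c) (∣⇒≤ {{>-nonZero (m<n⇒0<n∸m ρ<ρ')}} (divides ∣ q ℤ.- q' ∣ distance))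
      where
      d : ℕ
      d = ρ' ∸ ρ
      ρ'≡ : + ρ' ≡ + ρ ℤ.+ + d
      ρ'≡ = trans (cong +_ (sym (m+[n∸m]≡n (<⇒≤ ρ<ρ')))) (ℤ.pos-+ ρ d)
      open ≡-Reasoning
      distance : d ≡ ∣ q ℤ.- q' ∣ * c
      distance = begin
        d ≡⟨ cong ∣_∣ (begin
          + d                                                  ≡⟨ [a+b+x]-[a+x] (+ ρ) (+ d) (q' ℤ.* + c) ⟨
          (+ ρ ℤ.+ + d ℤ.+ q' ℤ.* + c) ℤ.- (+ ρ ℤ.+ q' ℤ.* + c)
            ≡⟨ cong (λ z → (z ℤ.+ q' ℤ.* + c) ℤ.- (+ ρ ℤ.+ q' ℤ.* + c)) ρ'≡ ⟨
          (+ ρ' ℤ.+ q' ℤ.* + c) ℤ.- (+ ρ ℤ.+ q' ℤ.* + c)       ≡⟨ cong (ℤ._- (+ ρ ℤ.+ q' ℤ.* + c)) eq ⟨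
          (+ ρ ℤ.+ q ℤ.* + c) ℤ.- (+ ρ ℤ.+ q' ℤ.* + c)         ≡⟨ [a+p*c]-[a+q*c] (+ ρ) q q' (+ c) ⟩
          (q ℤ.- q') ℤ.* + c                                   ∎) ⟩
        ∣ (q ℤ.- q') ℤ.* + c ∣ ≡⟨ ℤ.abs-* (q ℤ.- q') (+ c) ⟩
        ∣ q ℤ.- q' ∣ * c      ∎

    remainder-unique : ∀ {ρ ρ' : ℕ} {q q' : ℤ} → ρ < c → ρ' < c →
      + ρ ℤ.+ q ℤ.* + c ≡ + ρ' ℤ.+ q' ℤ.* + c → ρ ≡ ρ'
    remainder-unique {ρ} {ρ'} {q} {q'} ρ<c ρ'<c eq with <-cmp ρ ρ'
    ... | tri< ρ<ρ' _ _ = ⊥-elim (remainder-gap {q = q} {q'} ρ<ρ' ρ'<c eq)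
    ... | tri≈ _ ρ≡ρ' _ = ρ≡ρ'
    ... | tri> _ _ ρ'<ρ = ⊥-elim (remainder-gap {q = q'} {q} ρ'<ρ ρ<c (sym eq))

  module _ (c : ℕ) .{{_ : NonZero c}} where

    %ℕ-+-≡⇔∣ : ∀ (z : ℤ) h → z %ℕ c ≡ (z ℤ.+ + h) %ℕ c ⇔ c ∣ h
    %ℕ-+-≡⇔∣ z h = mk⇔ to from
      where
      z' : ℤ
      z' = z ℤ.+ + h
      split : ∀ w → w ≡ + (w %ℕ c) ℤ.+ (w /ℕ c) ℤ.* + c
      split w = a≡a%ℕn+[a/ℕn]*n w c
      open ≡-Reasoning
      to : z %ℕ c ≡ z' %ℕ c → c ∣ h
      to ρ≡ = divides ∣ z' /ℕ c ℤ.- z /ℕ c ∣ (begin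
        h ≡⟨ cong ∣_∣ (begin
          + h ≡⟨ b≡[a+b]-a z (+ h) ⟩
          z' ℤ.- z ≡⟨ cong₂ ℤ._-_ (split z') (split z) ⟩
          (+ (z' %ℕ c) ℤ.+ (z' /ℕ c) ℤ.* + c) ℤ.- (+ (z %ℕ c) ℤ.+ (z /ℕ c) ℤ.* + c)
            ≡⟨ cong (λ ρ → (+ (z' %ℕ c) ℤ.+ (z' /ℕ c) ℤ.* + c) ℤ.- (+ ρ ℤ.+ (z /ℕ c) ℤ.* + c)) ρ≡ ⟩
          (+ (z' %ℕ c) ℤ.+ (z' /ℕ c) ℤ.* + c) ℤ.- (+ (z' %ℕ c) ℤ.+ (z /ℕ c) ℤ.* + c)
            ≡⟨ [a+p*c]-[a+q*c] (+ (z' %ℕ c)) (z' /ℕ c) (z /ℕ c) (+ c) ⟩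
          (z' /ℕ c ℤ.- z /ℕ c) ℤ.* + c ∎) ⟩
        ∣ (z' /ℕ c ℤ.- z /ℕ c) ℤ.* + c ∣ ≡⟨ ℤ.abs-* (z' /ℕ c ℤ.- z /ℕ c) (+ c) ⟩
        ∣ z' /ℕ c ℤ.- z /ℕ c ∣ * c ∎)
      from : c ∣ h → z %ℕ c ≡ z' %ℕ c
      from (divides m h≡) = remainder-unique {q = z /ℕ c ℤ.+ + m} {q' = z' /ℕ c} (n%ℕd<d z c) (n%ℕd<d z' c) (begin
        + (z %ℕ c) ℤ.+ (z /ℕ c ℤ.+ + m) ℤ.* + c ≡⟨ [a+q*c]+m*c (+ (z %ℕ c)) (z /ℕ c) (+ m) (+ c) ⟩
        (+ (z %ℕ c) ℤ.+ (z /ℕ c) ℤ.* + c) ℤ.+ + m ℤ.* + c ≡⟨ cong₂ ℤ._+_ (split z) (ℤ.pos-* m c) ⟨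
        z ℤ.+ + (m * c) ≡⟨ cong (λ n → z ℤ.+ + n) h≡ ⟨
        z' ≡⟨ split z' ⟩
        + (z' %ℕ c) ℤ.+ (z' /ℕ c) ℤ.* + c ∎)

    residue-≡⇔∣ : ∀ {x₁ y₁ x₂ y₂ h} → x₂ + y₁ ≡ x₁ + y₂ + h → residue c x₁ y₁ ≡ residue c x₂ y₂ ⇔ c ∣ h
    residue-≡⇔∣ {x₁} {y₁} {x₂} {y₂} {h} eq =
      subst (λ z → residue c x₁ y₁ ≡ z %ℕ c ⇔ c ∣ h) (sym shifted) (%ℕ-+-≡⇔∣ (+ x₁ ℤ.- + y₁) h)
      where
      shifted : + x₂ ℤ.- + y₂ ≡ (+ x₁ ℤ.- + y₁) ℤ.+ + h
      shifted = difference-shift (+ x₁) (+ y₁) (+ x₂) (+ y₂) (+ h)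
        (trans (sym (ℤ.pos-+ x₂ y₁)) (trans (cong +_ eq) (trans (ℤ.pos-+ (x₁ + y₂) h) (cong (ℤ._+ + h) (ℤ.pos-+ x₁ y₂)))))

    residue<c : ∀ x y → residue c x y < c
    residue<c x y = n%ℕd<d (+ x ℤ.- + y) c

open Residues using (residue-≡⇔∣; residue<c)

multiplesUpTo : (m : ℕ) .{{_ : NonZero m}} → ℕ → ℕ
multiplesUpTo m K = countBelow (suc K) (λ t → (0 <ᵇ t) ∧ does (m ∣? t))

module _ (m : ℕ) .{{_ : NonZero m}} where

  multiplesUpTo-+rem : ∀ q ρ → ρ < m → multiplesUpTo m (q * m + ρ) ≡ multiplesUpTo m (q * m)
  multiplesUpTo-+rem q zero _ = cong (multiplesUpTo m) (+-identityʳ (q * m))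
  multiplesUpTo-+rem q (suc ρ) ρ<m = begin
    multiplesUpTo m (q * m + suc ρ)  ≡⟨ cong (multiplesUpTo m) (+-suc (q * m) ρ) ⟩
    multiplesUpTo m (q * m + ρ) + ⟦ does (m ∣? suc (q * m + ρ)) ⟧
      ≡⟨ cong₂ _+_ (multiplesUpTo-+rem q ρ (<⇒≤ ρ<m)) (⟦⟧-false (not-multiple ∘ from-∣?)) ⟩
    multiplesUpTo m (q * m) + 0     ≡⟨ +-identityʳ _ ⟩
    multiplesUpTo m (q * m)         ∎
    where
    open ≡-Reasoning
    not-multiple : ¬ m ∣ suc (q * m + ρ)
    not-multiple m∣ = <⇒≱ ρ<m (∣⇒≤ (∣m+n∣m⇒∣n (subst (m ∣_) (sym (+-suc (q * m) ρ)) m∣) (n∣m*n q)))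

  multiplesUpTo-* : ∀ q → multiplesUpTo m (q * m) ≡ q
  multiplesUpTo-* zero = refl
  multiplesUpTo-* (suc q) = begin
    multiplesUpTo m (suc q * m)              ≡⟨ cong (multiplesUpTo m) suc-q*m ⟩
    multiplesUpTo m (q * m + pred m) + ⟦ does (m ∣? suc (q * m + pred m)) ⟧
      ≡⟨ cong₂ _+_ (multiplesUpTo-+rem q (pred m) (pred[n]<n (>-nonZero⁻¹ m)))
                   (⟦⟧-true (to-∣? (subst (m ∣_) suc-q*m (n∣m*n (suc q))))) ⟩
    multiplesUpTo m (q * m) + 1              ≡⟨ cong (_+ 1) (multiplesUpTo-* q) ⟩
    q + 1                                    ≡⟨ +-comm q 1 ⟩
    suc q                                    ∎
    where
    open ≡-Reasoning
    suc-q*m : suc q * m ≡ suc (q * m + pred m)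
    suc-q*m = trans (+-comm m (q * m)) (trans (cong (λ n → q * m + n) (sym (suc-pred m))) (+-suc (q * m) (pred m)))

  multiplesUpTo≡/ : ∀ K → multiplesUpTo m K ≡ K / m
  multiplesUpTo≡/ K = begin
    multiplesUpTo m K                            ≡⟨ cong (multiplesUpTo m) (trans (m≡m%n+[m/n]*n K m) (+-comm (K % m) _)) ⟩
    multiplesUpTo m ((K / m) * m + K % m)        ≡⟨ multiplesUpTo-+rem (K / m) (K % m) (m%n<n K m) ⟩
    multiplesUpTo m ((K / m) * m)                ≡⟨ multiplesUpTo-* (K / m) ⟩
    K / m                                        ∎
    where open ≡-Reasoning

lcm-nonZero : ∀ m n .{{_ : NonZero m}} .{{_ : NonZero n}} → NonZero (lcm m n)
lcm-nonZero m n = ≢-nonZero (λ lcm≡0 → ≢-nonZero⁻¹ (m * n) {{m*n≢0 m n}}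
  (trans (sym (gcd*lcm m n)) (trans (cong (gcd m n *_) lcm≡0) (*-zeroʳ (gcd m n)))))

floorDiv≡/ : ∀ x d .{{_ : NonZero d}} → floorDiv x d ≡ x / d
floorDiv≡/ x (suc d) = refl

count-c∣n*t≡floorDiv : ∀ c n K .{{_ : NonZero c}} .{{_ : NonZero n}} →
  countBelow (suc K) (λ t → (0 <ᵇ t) ∧ does (c ∣? (n * t))) ≡ floorDiv (K * n) (lcm c n)
count-c∣n*t≡floorDiv c n K = begin
  countBelow (suc K) (λ t → (0 <ᵇ t) ∧ does (c ∣? (n * t)))
    ≡⟨ countBelow-cong (suc K) (λ t _ → ∧-congˡ (λ _ →
         mk⇔ (to-∣? ∘ c∣n*t⇒m∣t ∘ from-∣?) (to-∣? ∘ m∣t⇒c∣n*t ∘ from-∣?))) ⟩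
  multiplesUpTo m K  ≡⟨ multiplesUpTo≡/ m K ⟩
  K / m              ≡⟨ m*n/o*n≡m/o K n m ⟨
  K * n / (m * n)    ≡⟨ /-congʳ m*n≡L ⟩
  K * n / L          ≡⟨ floorDiv≡/ (K * n) L ⟨
  floorDiv (K * n) L ∎
  where
  open ≡-Reasoning
  L : ℕ
  L = lcm c n
  instance
    L-nonZero : NonZero L
    L-nonZero = lcm-nonZero c n
  m : ℕ
  m = L / n
  m*n≡L : m * n ≡ L
  m*n≡L = m/n*n≡m (n∣lcm[m,n] c n)
  instance
    m-nonZero : NonZero m
    m-nonZero = ≢-nonZero (λ m≡0 → ≢-nonZero⁻¹ L (trans (sym m*n≡L) (cong (_* n) m≡0)))
    m*n-nonZero : NonZero (m * n)
    m*n-nonZero = m*n≢0 m n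
  c∣n*t⇒m∣t : ∀ {t} → c ∣ n * t → m ∣ t
  c∣n*t⇒m∣t {t} c∣nt = *-cancelʳ-∣ n (subst₂ _∣_ (sym m*n≡L) (*-comm n t) (lcm-least c∣nt (m∣m*n t)))
  m∣t⇒c∣n*t : ∀ {t} → m ∣ t → c ∣ n * t
  m∣t⇒c∣n*t {t} m∣t = ∣-trans (m∣lcm[m,n] c n) (subst₂ _∣_ m*n≡L (*-comm t n) (*-monoˡ-∣ n m∣t))

coprime-proportional : ∀ {r s d e} .{{_ : NonZero r}} → Coprime r s → s * d ≡ r * e →
  Σ ℕ λ t → d ≡ r * t × e ≡ s * t
coprime-proportional {r} {s} {d} {e} cop sd≡re with coprime-divisor cop (divides e (trans sd≡re (*-comm r e)))
... | divides t d≡t*r = t , trans d≡t*r (*-comm t r) , *-cancelˡ-≡ e (s * t) r (begin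
  r * e       ≡⟨ sd≡re ⟨
  s * d       ≡⟨ cong (s *_) d≡t*r ⟩
  s * (t * r) ≡⟨ s*[t*r] s t r ⟩
  r * (s * t) ∎)
  where
  open ≡-Reasoning
  s*[t*r] : ∀ s t r → s * (t * r) ≡ r * (s * t)
  s*[t*r] = solve-∀

-- col la a = λ'_{a+1}, the height of the column above [a, a+1].
col : List ℕ → ℕ → ℕ
col la a = countBelow (length la) (λ j → a <ᵇ row la j)

row-beyond : ∀ la j → length la ≤ j → row la j ≡ 0
row-beyond [] j _ = refl
row-beyond (a ∷ la) (suc j) (s≤s L≤j) = row-beyond la j L≤j

0<row⇒<length : ∀ la {j} → 0 < row la j → j < length la
0<row⇒<length la {j} 0<row = ≰⇒> (λ L≤j → <⇒≢ 0<row (sym (row-beyond la j L≤j)))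

col-cons : ∀ a l z → col (a ∷ l) z ≡ ⟦ z <ᵇ a ⟧ + col l z
col-cons a l z = sumBelow-suc (length l) _

row-positive : ∀ {la} → IsPartition la → ∀ j → j < length la → 0 < row la j
row-positive (one 0<a) zero _ = 0<a
row-positive (one _) (suc j) (s≤s ())
row-positive (cons b≤a P) zero _ = ≤-trans (row-positive P zero z<s) b≤a
row-positive (cons b≤a P) (suc j) (s≤s j<L) = row-positive P j j<L

row-suc-≤ : ∀ {la} → IsPartition la → ∀ j → row la (suc j) ≤ row la j
row-suc-≤ nil j = z≤n
row-suc-≤ (one _) j = z≤n
row-suc-≤ (cons b≤a P) zero = b≤a
row-suc-≤ (cons b≤a P) (suc j) = row-suc-≤ P j

row-antitone : ∀ {la} → IsPartition la → ∀ {j j'} → j ≤ j' → row la j' ≤ row la j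
row-antitone {la} P {j} {j'} j≤j' = subst (λ j' → row la j' ≤ row la j) (m+[n∸m]≡n j≤j') (go (j' ∸ j))
  where
  go : ∀ d → row la (j + d) ≤ row la j
  go zero = ≤-reflexive (cong (row la) (+-identityʳ j))
  go (suc d) = ≤-trans (≤-reflexive (cong (row la) (+-suc j d))) (≤-trans (row-suc-≤ P (j + d)) (go d))

tail-isPartition : ∀ {a l} → IsPartition (a ∷ l) → IsPartition l
tail-isPartition (one _) = nil
tail-isPartition (cons _ P) = P

tail-row-≤-head : ∀ {a l} → IsPartition (a ∷ l) → ∀ j → row l j ≤ a
tail-row-≤-head P j = row-antitone P (z≤n {suc j})

module _ {la : List ℕ} (P : IsPartition la) where

  <col⇔<row : ∀ a j → j < col la a ⇔ a < row la j
  <col⇔<row a j = mk⇔ (from-<ᵇ ∘ proj₂ ∘ Equivalence.to (spec j)) (λ a<row → Equivalence.from (spec j) (j<L a<row , <⇒<ᵇ a<row))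
    where
    spec : ∀ j → j < col la a ⇔ (j < length la × T (a <ᵇ row la j))
    spec = countBelow-downClosed (length la) (λ j → a <ᵇ row la j)
             (λ i j i≤j a<rowj → <⇒<ᵇ (<-≤-trans (from-<ᵇ a<rowj) (row-antitone P i≤j)))
    j<L : a < row la j → j < length la
    j<L a<row = 0<row⇒<length la (≤-<-trans z≤n a<row)

  col≤⇔row≤ : ∀ a y → col la a ≤ y ⇔ row la y ≤ a
  col≤⇔row≤ a y = mk⇔ (λ col≤y → ≮⇒≥ (λ a<row → <⇒≱ (Equivalence.from (<col⇔<row a y) a<row) col≤y))
                      (λ row≤a → ≮⇒≥ (λ y<col → <⇒≱ (Equivalence.to (<col⇔<row a y) y<col) row≤a))

  col≤length : ∀ a → col la a ≤ length la
  col≤length a = Equivalence.from (col≤⇔row≤ a (length la)) (subst (_≤ a) (sym (row-beyond la (length la) ≤-refl)) z≤n)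

  leg≡col∸ : ∀ i j → leg la i j ≡ col la i ∸ suc j
  leg≡col∸ i j = trans
    (countBelow-cong (length la) (λ j' _ → ∧-congˡ (λ _ →
      mk⇔ (<⇒<ᵇ ∘ Equivalence.from (<col⇔<row i j') ∘ from-<ᵇ) (<⇒<ᵇ ∘ Equivalence.to (<col⇔<row i j') ∘ from-<ᵇ))))
    (countBelow-interval (length la) j (col la i) (col≤length i))

  eastEdge≡ : ∀ x y → eastEdge la x y ≡ (y ≡ᵇ col la x)
  eastEdge≡ x zero = trans (∨-identityʳ (row la 0 ≤ᵇ x)) (T-⇔⇒≡ (mk⇔
    (λ t → to-≡ᵇ (sym (n≤0⇒n≡0 (Equivalence.from (col≤⇔row≤ x 0) (from-≤ᵇ t)))))
    (λ t → ≤⇒≤ᵇ (Equivalence.to (col≤⇔row≤ x 0) (≤-reflexive (sym (from-≡ᵇ t)))))))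
  eastEdge≡ x (suc y) = T-⇔⇒≡ (mk⇔
    (λ t → to-≡ᵇ (≤-antisym (Equivalence.from (<col⇔<row x y) (from-<ᵇ (∧-elimʳ {row la (suc y) ≤ᵇ x} t)))
                            (Equivalence.from (col≤⇔row≤ x (suc y)) (from-≤ᵇ (∧-elimˡ t)))))
    (λ t → ∧-intro (≤⇒≤ᵇ (Equivalence.to (col≤⇔row≤ x (suc y)) (≤-reflexive (sym (from-≡ᵇ t)))))
                   (<⇒<ᵇ (Equivalence.to (<col⇔<row x y) (≤-reflexive (from-≡ᵇ t))))))

  southEdge≡ : ∀ x y → southEdge la x y ≡ (x ≡ᵇ row la y)
  southEdge≡ zero y = trans (∨-identityʳ (length la ≤ᵇ y)) (T-⇔⇒≡ (mk⇔
    (λ t → to-≡ᵇ (sym (row-beyond la y (from-≤ᵇ t))))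
    (λ t → ≤⇒≤ᵇ (≮⇒≥ (λ y<L → <⇒≢ (row-positive P y y<L) (from-≡ᵇ t))))))
  southEdge≡ (suc x) y = T-⇔⇒≡ (≡ᵇ-⇔ {row la y} {suc x} sym sym)

-- Boxes with arm p and leg q + 1: in row j it is the box in column row j ∸ suc p.
armLegBoxes : List ℕ → ℕ → ℕ → ℕ
armLegBoxes la p q =
  countBelow (length la) (λ j → (suc p ≤ᵇ row la j) ∧ (col la (row la j ∸ suc p) ≡ᵇ suc (j + suc q)))

-- Rows y whose cell (λ_{y+1} + p, y) lies q + 1 rows above the top of its column.
outerPairs : List ℕ → ℕ → ℕ → ℕ
outerPairs la p q = countBelow (length la + suc (suc q)) (λ y → col la (row la y + p) + suc q ≡ᵇ y)

≤∸suc⇔+< : ∀ {m p a} → suc p ≤ a → m ≤ a ∸ suc p ⇔ m + p < a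
≤∸suc⇔+< {m} {p} {a} p<a = mk⇔ (λ m≤ → subst (_≤ a) (+-suc m p) (m≤o∸n⇒m+n≤o m p<a m≤))
                               (λ m+p<a → m+n≤o⇒m≤o∸n m (subst (_≤ a) (sym (+-suc m p)) m+p<a))

∸suc< : ∀ {p a} → suc p ≤ a → a ∸ suc p < a
∸suc< {p} {suc a} _ = s≤s (m∸n≤m a p)

⟦not<ᵇ⟧-split : ∀ {u w} a → u ≤ w →
  ⟦ not (w <ᵇ a) ⟧ ≡ ⟦ not (u <ᵇ a) ⟧ + ⟦ (u <ᵇ a) ∧ not (w <ᵇ a) ⟧
⟦not<ᵇ⟧-split {u} {w} a u≤w with u <ᵇ a in u<a | w <ᵇ a in w<a
... | true  | true  = refl
... | true  | false = refl
... | false | false = refl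
... | false | true  = ⊥-elim (subst T u<a (<⇒<ᵇ (≤-<-trans u≤w (from-<ᵇ {w} {a} (subst T (sym w<a) _)))))

-- Adding the first row a changes the outer pairs exactly by the first-row box (if any).
module FirstRow {a l} (P : IsPartition (a ∷ l)) (p q : ℕ) where

  K : ℕ
  K = length l + suc (suc q)

  x : ℕ → ℕ
  x y = row l y + p

  inTail : ℕ → Bool
  inTail y = col l (x y) + suc q ≡ᵇ y

  A : ℕ
  A = countBelow K (λ y → (x y <ᵇ a) ∧ inTail y)

  firstRowBox : Bool
  firstRowBox = (suc p ≤ᵇ a) ∧ (col (a ∷ l) (a ∸ suc p) ≡ᵇ suc (suc q))

  col-tail-≥ : ∀ {z} → a ≤ z → col l z ≡ 0
  col-tail-≥ a≤z = n≤0⇒n≡0 (Equivalence.from (col≤⇔row≤ (tail-isPartition P) _ 0) (≤-trans (tail-row-≤-head P 0) a≤z))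

  col-head-< : ∀ {z} → z < a → col (a ∷ l) z ≡ suc (col l z)
  col-head-< {z} z<a = trans (col-cons a l z) (cong (_+ col l z) (⟦⟧-true (<⇒<ᵇ z<a)))

  col-head-≥ : ∀ {z} → a ≤ z → col (a ∷ l) z ≡ 0
  col-head-≥ {z} a≤z = trans (col-cons a l z) (cong₂ _+_ (⟦⟧-false (λ t → <⇒≱ (from-<ᵇ t) a≤z)) (col-tail-≥ a≤z))

  outside-single : ∀ (c : ℕ → Bool) e → e < K → (∀ y → a ≤ x y → T (c y) ⇔ y ≡ e) →
    countBelow K (λ y → not (x y <ᵇ a) ∧ c y) ≡ ⟦ not (x e <ᵇ a) ⟧
  outside-single c e e<K c⇔≡e =
    trans (sumBelow-single K _ e e<K (λ y _ y≢e → ⟦⟧-false (λ t →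
             y≢e (Equivalence.to (c⇔≡e y (out (∧-elimˡ t))) (∧-elimʳ {not (x y <ᵇ a)} t)))))
          (cong ⟦_⟧ (T-⇔⇒≡ (mk⇔ ∧-elimˡ (λ t → ∧-intro t (Equivalence.from (c⇔≡e e (out t)) refl)))))
    where
    out : ∀ {y} → T (not (x y <ᵇ a)) → a ≤ x y
    out t = ≮⇒≥ (not-elim t ∘ <⇒<ᵇ)

  outerPairs-tail : outerPairs l p q ≡ A + ⟦ not (x (suc q) <ᵇ a) ⟧
  outerPairs-tail = begin
    countBelow K inTail
      ≡⟨ sumBelow-cong K (λ y _ → ⟦⟧-split (x y <ᵇ a) (inTail y)) ⟩
    sumBelow K (λ y → ⟦ (x y <ᵇ a) ∧ inTail y ⟧ + ⟦ not (x y <ᵇ a) ∧ inTail y ⟧)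
      ≡⟨ sumBelow-+ K _ _ ⟩
    A + countBelow K (λ y → not (x y <ᵇ a) ∧ inTail y)
      ≡⟨ cong (A +_) (outside-single inTail (suc q) (m≤n+m (suc (suc q)) (length l)) inTail⇔) ⟩
    A + ⟦ not (x (suc q) <ᵇ a) ⟧ ∎
    where
    open ≡-Reasoning
    inTail⇔ : ∀ y → a ≤ x y → T (inTail y) ⇔ y ≡ suc q
    inTail⇔ y a≤x rewrite col-tail-≥ a≤x = mk⇔ (λ t → sym (from-≡ᵇ {suc q} t)) (to-≡ᵇ ∘ sym)

  outerPairs-cons : outerPairs (a ∷ l) p q ≡ A + ⟦ not (x q <ᵇ a) ⟧
  outerPairs-cons = begin
    outerPairs (a ∷ l) p q
      ≡⟨ sumBelow-suc K _ ⟩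
    ⟦ col (a ∷ l) (a + p) + suc q ≡ᵇ 0 ⟧ + countBelow K inHead
      ≡⟨ cong₂ _+_ (⟦⟧-false (λ t → 1+n≢0 (trans (sym (+-suc (col (a ∷ l) (a + p)) q)) (from-≡ᵇ t))))
                   (sumBelow-cong K (λ y _ → ⟦⟧-split (x y <ᵇ a) (inHead y))) ⟩
    sumBelow K (λ y → ⟦ (x y <ᵇ a) ∧ inHead y ⟧ + ⟦ not (x y <ᵇ a) ∧ inHead y ⟧)
      ≡⟨ sumBelow-+ K _ _ ⟩
    countBelow K (λ y → (x y <ᵇ a) ∧ inHead y) + countBelow K (λ y → not (x y <ᵇ a) ∧ inHead y)
      ≡⟨ cong₂ _+_ (countBelow-cong K (λ y _ → inside y))
                   (outside-single inHead q (≤-trans (n≤1+n (suc q)) (m≤n+m (suc (suc q)) (length l))) inHead⇔) ⟩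
    A + ⟦ not (x q <ᵇ a) ⟧ ∎
    where
    open ≡-Reasoning
    inHead : ℕ → Bool
    inHead y = col (a ∷ l) (x y) + suc q ≡ᵇ suc y
    inside : ∀ y → T ((x y <ᵇ a) ∧ inHead y) ⇔ T ((x y <ᵇ a) ∧ inTail y)
    inside y = ∧-congˡ (λ x<a → let col≡ = cong (_+ suc q) (col-head-< (from-<ᵇ x<a)) in
      ≡ᵇ-⇔ (λ e → suc-injective (trans (sym col≡) e)) (λ e → trans col≡ (cong suc e)))
    inHead⇔ : ∀ y → a ≤ x y → T (inHead y) ⇔ y ≡ q
    inHead⇔ y a≤x rewrite col-head-≥ a≤x = mk⇔ (λ t → sym (suc-injective (from-≡ᵇ {suc q} t))) (to-≡ᵇ ∘ cong suc ∘ sym)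

  armLegBoxes-cons : armLegBoxes (a ∷ l) p q ≡ ⟦ firstRowBox ⟧ + armLegBoxes l p q
  armLegBoxes-cons = trans (sumBelow-suc (length l) _) (cong (⟦ firstRowBox ⟧ +_) (countBelow-cong (length l) tailRow))
    where
    col-head : ∀ {j} → suc p ≤ row l j → col (a ∷ l) (row l j ∸ suc p) ≡ suc (col l (row l j ∸ suc p))
    col-head {j} p<row = col-head-< (<-≤-trans (∸suc< p<row) (tail-row-≤-head P j))
    tailRow : ∀ j → j < length l →
      T ((suc p ≤ᵇ row l j) ∧ (col (a ∷ l) (row l j ∸ suc p) ≡ᵇ suc (suc j + suc q))) ⇔
      T ((suc p ≤ᵇ row l j) ∧ (col l (row l j ∸ suc p) ≡ᵇ suc (j + suc q)))
    tailRow j _ = ∧-congˡ (λ p<row → let col≡ = col-head (from-≤ᵇ p<row) in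
      ≡ᵇ-⇔ (λ e → suc-injective (trans (sym col≡) e)) (λ e → trans col≡ (cong suc e)))

  firstRowBox≡ : firstRowBox ≡ (x (suc q) <ᵇ a) ∧ not (x q <ᵇ a)
  firstRowBox≡ = T-⇔⇒≡ (mk⇔ to from)
    where
    Pl : IsPartition l
    Pl = tail-isPartition P
    to : T firstRowBox → T ((x (suc q) <ᵇ a) ∧ not (x q <ᵇ a))
    to t = ∧-intro (<⇒<ᵇ below) (not-intro (λ xq<a → <⇒≱ (from-<ᵇ xq<a) above))
      where
      p<a : suc p ≤ a
      p<a = from-≤ᵇ (∧-elimˡ t)
      z : ℕ
      z = a ∸ suc p
      colz : col l z ≡ suc q
      colz = suc-injective (trans (sym (col-head-< (∸suc< p<a))) (from-≡ᵇ (∧-elimʳ {suc p ≤ᵇ a} t)))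
      below : x (suc q) < a
      below = Equivalence.to (≤∸suc⇔+< p<a) (Equivalence.to (col≤⇔row≤ Pl z (suc q)) (≤-reflexive colz))
      above : a ≤ x q
      above = ≮⇒≥ (λ xq<a → <⇒≱ (Equivalence.to (<col⇔<row Pl z q) (≤-reflexive (sym colz)))
                                 (Equivalence.from (≤∸suc⇔+< p<a) xq<a))
    from : T ((x (suc q) <ᵇ a) ∧ not (x q <ᵇ a)) → T firstRowBox
    from t = ∧-intro (≤⇒≤ᵇ p<a) (to-≡ᵇ (trans (col-head-< (∸suc< p<a)) (cong suc (≤-antisym colz≤ colz≥))))
      where
      below : x (suc q) < a
      below = from-<ᵇ (∧-elimˡ t)
      above : a ≤ x q
      above = ≮⇒≥ (not-elim (∧-elimʳ {x (suc q) <ᵇ a} t) ∘ <⇒<ᵇ)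
      p<a : suc p ≤ a
      p<a = ≤-trans (s≤s (m≤n+m p (row l (suc q)))) below
      z : ℕ
      z = a ∸ suc p
      colz≤ : col l z ≤ suc q
      colz≤ = Equivalence.from (col≤⇔row≤ Pl z (suc q)) (Equivalence.from (≤∸suc⇔+< p<a) below)
      colz≥ : suc q ≤ col l z
      colz≥ = Equivalence.from (<col⇔<row Pl z q)
                (≰⇒> (λ row≤z → <⇒≱ (Equivalence.to (≤∸suc⇔+< p<a) row≤z) above))

outerPairs≡1+armLegBoxes : ∀ {la} → IsPartition la → ∀ p q → outerPairs la p q ≡ suc (armLegBoxes la p q)
outerPairs≡1+armLegBoxes nil p q =
  countBelow-unique (suc (suc q)) _ (suc q) ≤-refl (to-≡ᵇ {suc q} refl) (λ i _ t → sym (from-≡ᵇ t))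
outerPairs≡1+armLegBoxes {a ∷ l} P p q = begin
  outerPairs (a ∷ l) p q
    ≡⟨ outerPairs-cons ⟩
  A + ⟦ not (x q <ᵇ a) ⟧
    ≡⟨ cong (A +_) (⟦not<ᵇ⟧-split a (+-monoˡ-≤ p (row-suc-≤ Pl q))) ⟩
  A + (⟦ not (x (suc q) <ᵇ a) ⟧ + ⟦ (x (suc q) <ᵇ a) ∧ not (x q <ᵇ a) ⟧)
    ≡⟨ +-assoc A _ _ ⟨
  A + ⟦ not (x (suc q) <ᵇ a) ⟧ + ⟦ (x (suc q) <ᵇ a) ∧ not (x q <ᵇ a) ⟧
    ≡⟨ cong₂ _+_ (sym outerPairs-tail) (cong ⟦_⟧ (sym firstRowBox≡)) ⟩
  outerPairs l p q + ⟦ firstRowBox ⟧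
    ≡⟨ cong (_+ ⟦ firstRowBox ⟧) (outerPairs≡1+armLegBoxes Pl p q) ⟩
  suc (armLegBoxes l p q + ⟦ firstRowBox ⟧)
    ≡⟨ cong suc (trans (+-comm _ ⟦ firstRowBox ⟧) (sym armLegBoxes-cons)) ⟩
  suc (armLegBoxes (a ∷ l) p q) ∎
  where
  open ≡-Reasoning
  open FirstRow P p q
  Pl : IsPartition l
  Pl = tail-isPartition P

addBox-row-≤ : ∀ la j j' → row la j' ≤ row (addBox la j) j'
addBox-row-≤ [] zero zero = z≤n
addBox-row-≤ [] zero (suc j') = z≤n
addBox-row-≤ [] (suc j) zero = z≤n
addBox-row-≤ [] (suc j) (suc j') = addBox-row-≤ [] j j'
addBox-row-≤ (a ∷ la) zero zero = n≤1+n a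
addBox-row-≤ (a ∷ la) zero (suc j') = ≤-refl
addBox-row-≤ (a ∷ la) (suc j) zero = ≤-refl
addBox-row-≤ (a ∷ la) (suc j) (suc j') = addBox-row-≤ la j j'

module _ {r s c : ℕ} .{{_ : NonZero c}} where

  Successor-row-≤ : ∀ {la mu} → Successor r s c la mu → ∀ j → row la j ≤ row mu j
  Successor-row-≤ {la} (i , _ , _ , refl) = addBox-row-≤ la i

  PartLt-row-≤ : ∀ {la mu} → PartLt r s c la mu → ∀ j → row la j ≤ row mu j
  PartLt-row-≤ [ la≺mu ] j = Successor-row-≤ la≺mu j
  PartLt-row-≤ (la≺nu ∷ nu<mu) j = ≤-trans (Successor-row-≤ la≺nu j) (PartLt-row-≤ nu<mu j)

row-filter-≤ : ∀ {p} {P : Pred ℕ p} (P? : Decidable P) xs j → ∃[ j' ] j ≤ j' × row (filter P? xs) j ≤ row xs j'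
row-filter-≤ P? [] j = j , ≤-refl , z≤n
row-filter-≤ P? (x ∷ xs) j with does (P? x)
... | false = let (j' , j≤j' , ≤row) = row-filter-≤ P? xs j in suc j' , m≤n⇒m≤1+n j≤j' , ≤row
row-filter-≤ P? (x ∷ xs) zero | true = 0 , z≤n , ≤-refl
row-filter-≤ P? (x ∷ xs) (suc j) | true = let (j' , j≤j' , ≤row) = row-filter-≤ P? xs j in suc j' , s≤s j≤j' , ≤row

row-map-applyUpTo-≤ : ∀ (f g : ℕ → ℕ) n j → row (map f (applyUpTo g n)) j ≤ f (g j)
row-map-applyUpTo-≤ f g zero j = z≤n
row-map-applyUpTo-≤ f g (suc n) zero = ≤-refl
row-map-applyUpTo-≤ f g (suc n) (suc j) = row-map-applyUpTo-≤ f (g ∘ suc) n j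

module _ (r s k : ℕ) where

  rowRSK-antitone : ∀ {j j'} → j ≤ j' → rowRSK r s k j' ≤ rowRSK r s k j
  rowRSK-antitone j≤j' = sumBelow-mono k (λ i _ → ⟦⟧-≤ (λ t →
    ≤⇒≤ᵇ (≤-trans (+-monoʳ-≤ (s * suc i) (*-monoʳ-≤ r (s≤s j≤j'))) (from-≤ᵇ t))))

  rowRSK-corner : ∀ j → 0 < rowRSK r s k j → s * rowRSK r s k j + r * suc j ≤ k
  rowRSK-corner j 0<row = subst (λ i → s * i + r * suc j ≤ k) (suc-pred (rowRSK r s k j) {{>-nonZero 0<row}})
    (from-≤ᵇ (proj₂ (Equivalence.to (countBelow-downClosed k _ down (pred (rowRSK r s k j))) (pred[n]<n 0<row))))
    where
    down : ∀ i i' → i ≤ i' → T (s * suc i' + r * suc j ≤ᵇ k) → T (s * suc i + r * suc j ≤ᵇ k)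
    down i i' i≤i' t = ≤⇒≤ᵇ (≤-trans (+-monoˡ-≤ (r * suc j) (*-monoʳ-≤ s (s≤s i≤i'))) (from-≤ᵇ t))

  row-lambdaRSK-≤ : ∀ j → row (lambdaRSK r s k) j ≤ rowRSK r s k j
  row-lambdaRSK-≤ j = let (j' , j≤j' , ≤row) = row-filter-≤ _ (map (rowRSK r s k) (applyUpTo (λ i → i) k)) j in
    ≤-trans ≤row (≤-trans (row-map-applyUpTo-≤ (rowRSK r s k) (λ i → i) k j') (rowRSK-antitone j≤j'))

PartLt-lambdaRSK⇒corner≤ : ∀ {r s c k} .{{_ : NonZero c}} {la} → IsPartition la →
  PartLt r s c la (lambdaRSK r s k) → ∀ j → j < length la → s * row la j + r * suc j ≤ k
PartLt-lambdaRSK⇒corner≤ {r} {s} {c} {k} {la} P la<λ j j<L =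
  ≤-trans (+-monoˡ-≤ (r * suc j) (*-monoʳ-≤ s row≤)) (rowRSK-corner r s k j (<-≤-trans (row-positive P j j<L) row≤))
  where
  row≤ : row la j ≤ rowRSK r s k j
  row≤ = ≤-trans (PartLt-row-≤ {r} {s} {c} la<λ j) (row-lambdaRSK-≤ r s k j)

module BoundaryPairs (r s c : ℕ) .{{_ : NonZero c}} (0<r : 0 < r) (0<s : 0 < s)
                     {la : List ℕ} (P : IsPartition la) (k : ℕ) where

  instance
    r-nonZero : NonZero r
    r-nonZero = >-nonZero 0<r
    s-nonZero : NonZero s
    s-nonZero = >-nonZero 0<s

  -- (eastV a , eastRes a) and (southV y , southRes y) are the vertices of M at the targets
  -- of the east edge in column a and of the south edge in row y.
  eastV : ℕ → ℕ
  eastV a = s * suc a + r * col la a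

  southV : ℕ → ℕ
  southV y = s * row la y + r * y

  eastRes : ℕ → ℕ
  eastRes a = residue c (suc a) (col la a)

  southRes : ℕ → ℕ
  southRes y = residue c (row la y) y

  linked : ℕ → ℕ → Bool
  linked a y = (eastV a <ᵇ suc k) ∧ ((eastV a ≡ᵇ southV y) ∧ (eastRes a ≡ᵇ southRes y))

  linkedPairs : ℕ
  linkedPairs = sumBelow (suc k) (λ a → countBelow (suc k) (linked a))

  inClass⇒x< : ∀ {v j x y} → T (inClass r s c v j x y) → x < suc v
  inClass⇒x< {v} {j} {x} {y} t = s≤s (≤-trans (m≤n*m x s) (≤-trans (m≤m+n (s * x) (r * y)) (≤-reflexive (from-≡ᵇ (∧-elimˡ t)))))

  inClass⇒y< : ∀ {v j x y} → T (inClass r s c v j x y) → y < suc v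
  inClass⇒y< {v} {j} {x} {y} t = s≤s (≤-trans (m≤n*m y r) (≤-trans (m≤n+m (r * y) (s * x)) (≤-reflexive (from-≡ᵇ (∧-elimˡ t)))))

  Ein≡ : ∀ v j → Ein r s c la v j ≡ countBelow (suc v) (λ a → inClass r s c v j (suc a) (col la a))
  Ein≡ v j = sumBelow-cong (suc v) (λ a _ → trans
    (sumBelow-cong (suc v) (λ y _ → cong (λ b → ⟦ b ∧ inClass r s c v j (suc a) y ⟧) (eastEdge≡ P a y)))
    (countBelow-at-< (suc v) (col la a) (inClass r s c v j (suc a)) inClass⇒y<))

  Sin≡ : ∀ v j → Sin r s c la v j ≡ countBelow (suc v) (λ y → inClass r s c v j (row la y) y)
  Sin≡ v j = trans (sumBelow-swap (suc v) (suc v) _) (sumBelow-cong (suc v) (λ y _ → trans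
    (sumBelow-cong (suc v) (λ x _ → cong (λ b → ⟦ b ∧ inClass r s c v j x y ⟧) (southEdge≡ P x y)))
    (countBelow-at-< (suc v) (row la y) (λ x → inClass r s c v j x y) inClass⇒x<)))

  edgeTerm≡ : ∀ v j → (if isVertex r s c v j then Ein r s c la v j * Sin r s c la v j else 0) ≡ Ein r s c la v j * Sin r s c la v j
  edgeTerm≡ v j with isVertex r s c v j in vertex
  ... | true = refl
  ... | false = sym (trans (cong (Ein r s c la v j *_) (n≤0⇒n≡0 (≤-trans Sin≤class (≤-reflexive (empty vertex)))))
                           (*-zeroʳ (Ein r s c la v j)))
    where
    empty : ∀ {n} → (0 <ᵇ n) ≡ false → n ≡ 0
    empty {zero} _ = refl
    Sin≤class : Sin r s c la v j ≤ sumBelow (suc v) (λ x → countBelow (suc v) (λ y → inClass r s c v j x y))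
    Sin≤class = sumBelow-mono (suc v) (λ x _ → sumBelow-mono (suc v) (λ y _ → ⟦⟧-≤ (∧-elimʳ {southEdge la x y})))

  Ein*Sin≡ : ∀ v → v < suc k → ∀ j → Ein r s c la v j * Sin r s c la v j ≡
    sumBelow (suc k) (λ a → countBelow (suc k) (λ y → inClass r s c v j (suc a) (col la a) ∧ inClass r s c v j (row la y) y))
  Ein*Sin≡ v v<k j = begin
    Ein r s c la v j * Sin r s c la v j
      ≡⟨ cong₂ _*_ (Ein≡ v j) (Sin≡ v j) ⟩
    countBelow (suc v) (λ a → east a) * countBelow (suc v) south
      ≡⟨ sumBelow-*-sumBelow (suc v) (suc v) _ _ ⟩
    sumBelow (suc v) (λ a → sumBelow (suc v) (λ y → ⟦ east a ⟧ * ⟦ south y ⟧))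
      ≡⟨ sumBelow-cong (suc v) (λ a _ → sumBelow-cong (suc v) (λ y _ → sym (⟦∧⟧ (east a) (south y)))) ⟩
    sumBelow (suc v) (λ a → countBelow (suc v) (λ y → east a ∧ south y))
      ≡⟨ sumBelow-cong (suc v) (λ a _ → sym (countBelow-pad (suc v) (suc k) _ v<k
           (λ y v<y _ t → <⇒≱ (inClass⇒y< (∧-elimʳ {east a} t)) v<y))) ⟩
    sumBelow (suc v) (λ a → countBelow (suc k) (λ y → east a ∧ south y))
      ≡⟨ sym (sumBelow-pad (suc v) (suc k) _ v<k
           (λ a v<a _ → countBelow-none (suc k) (λ y _ t → <⇒≱ (inClass⇒x< (∧-elimˡ t)) (m≤n⇒m≤1+n v<a)))) ⟩
    sumBelow (suc k) (λ a → countBelow (suc k) (λ y → east a ∧ south y)) ∎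
    where
    open ≡-Reasoning
    east : ℕ → Bool
    east a = inClass r s c v j (suc a) (col la a)
    south : ℕ → Bool
    south y = inClass r s c v j (row la y) y

  classSum : ∀ x₁ y₁ x₂ y₂ →
    sumBelow (suc k) (λ v → countBelow c (λ j → inClass r s c v j x₁ y₁ ∧ inClass r s c v j x₂ y₂))
      ≡ ⟦ (s * x₁ + r * y₁ <ᵇ suc k) ∧
          ((s * x₁ + r * y₁ ≡ᵇ s * x₂ + r * y₂) ∧ (residue c x₁ y₁ ≡ᵇ residue c x₂ y₂)) ⟧
  classSum x₁ y₁ x₂ y₂ = trans
    (sumBelow-cong (suc k) (λ v _ → trans (countBelow-cong c (λ j _ → sameClass⇔ {v} {j} {V₁} {ρ₁} {V₂} {ρ₂}))
                                          (countBelow-at-< c ρ₁ (λ _ → (v ≡ᵇ V₁) ∧ ((V₁ ≡ᵇ V₂) ∧ (ρ₁ ≡ᵇ ρ₂)))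
                                                           (λ _ → residue<c c x₁ y₁))))
    (countBelow-at (suc k) V₁ (λ _ → (V₁ ≡ᵇ V₂) ∧ (ρ₁ ≡ᵇ ρ₂)))
    where
    V₁ V₂ ρ₁ ρ₂ : ℕ
    V₁ = s * x₁ + r * y₁
    V₂ = s * x₂ + r * y₂
    ρ₁ = residue c x₁ y₁
    ρ₂ = residue c x₂ y₂

  edgeSum≡linkedPairs : edgeSum r s c la k ≡ linkedPairs
  edgeSum≡linkedPairs = begin
    edgeSum r s c la k
      ≡⟨ sumBelow-cong (suc k) (λ v v<k → sumBelow-cong c (λ j _ → trans (edgeTerm≡ v j) (Ein*Sin≡ v v<k j))) ⟩
    sumBelow (suc k) (λ v → sumBelow c (λ j → sumBelow (suc k) (λ a → countBelow (suc k) (λ y → pair v j a y))))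
      ≡⟨ sumBelow-cong (suc k) (λ v _ → trans (sumBelow-swap c (suc k) _) (sumBelow-cong (suc k) (λ a _ → sumBelow-swap c (suc k) _))) ⟩
    sumBelow (suc k) (λ v → sumBelow (suc k) (λ a → sumBelow (suc k) (λ y → countBelow c (λ j → pair v j a y))))
      ≡⟨ trans (sumBelow-swap (suc k) (suc k) _) (sumBelow-cong (suc k) (λ a _ → sumBelow-swap (suc k) (suc k) _)) ⟩
    sumBelow (suc k) (λ a → sumBelow (suc k) (λ y → sumBelow (suc k) (λ v → countBelow c (λ j → pair v j a y))))
      ≡⟨ sumBelow-cong (suc k) (λ a _ → sumBelow-cong (suc k) (λ y _ → classSum (suc a) (col la a) (row la y) y)) ⟩
    linkedPairs ∎
    where
    open ≡-Reasoning
    pair : ℕ → ℕ → ℕ → ℕ → Bool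
    pair v j a y = inClass r s c v j (suc a) (col la a) ∧ inClass r s c v j (row la y) y

private
  east-shape : ∀ s a r y b → s * suc a + r * (suc y + b) ≡ s * suc a + r * y + r * (b + 1)
  east-shape = solve-∀
  south-shape : ∀ s a r y α → s * (suc a + α) + r * y ≡ s * suc a + r * y + s * α
  south-shape = solve-∀
  hook-shape : ∀ a α y β → suc a + α + (suc y + β) ≡ suc a + y + (α + β + 1)
  hook-shape = solve-∀

module Inside (r s c : ℕ) .{{_ : NonZero c}} (0<r : 0 < r) (0<s : 0 < s)
              {la : List ℕ} (P : IsPartition la) (k : ℕ)
              (corner≤ : ∀ j → j < length la → s * row la j + r * suc j ≤ k) where

  open BoundaryPairs r s c 0<r 0<s P k

  insidePairs : ℕ
  insidePairs = sumBelow (suc k) (λ a → countBelow (suc k) (λ y → (a <ᵇ row la y) ∧ linked a y))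

  outsidePairs : ℕ
  outsidePairs = sumBelow (suc k) (λ a → countBelow (suc k) (λ y → not (a <ᵇ row la y) ∧ linked a y))

  linkedPairs≡inside+outside : linkedPairs ≡ insidePairs + outsidePairs
  linkedPairs≡inside+outside = trans
    (sumBelow-cong (suc k) (λ a _ → trans (sumBelow-cong (suc k) (λ y _ → ⟦⟧-split (a <ᵇ row la y) (linked a y)))
                                          (sumBelow-+ (suc k) _ _)))
    (sumBelow-+ (suc k) _ _)

  eastV≤k : ∀ a → 0 < col la a → eastV a ≤ k
  eastV≤k a 0<col = ≤-trans (+-monoˡ-≤ (r * col la a) (*-monoʳ-≤ s (Equivalence.to (<col⇔<row P a j) j<col)))
                            (subst (λ h → s * row la j + r * h ≤ k) (suc-pred (col la a) {{>-nonZero 0<col}}) (corner≤ j j<L))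
    where
    j : ℕ
    j = pred (col la a)
    j<col : j < col la a
    j<col = pred[n]<n 0<col
    j<L : j < length la
    j<L = <-≤-trans j<col (col≤length P a)

  critPlusBox : ℕ → ℕ → Bool
  critPlusBox i j = does (c ∣? hook la i j) ∧ (s * arm la i j ≡ᵇ r * (leg la i j + 1))

  module Box {a y : ℕ} (a<row : a < row la y) where

    row≡ : row la y ≡ suc a + arm la a y
    row≡ = sym (m+[n∸m]≡n a<row)

    y<col : y < col la a
    y<col = Equivalence.from (<col⇔<row P a y) a<row

    col≡ : col la a ≡ suc y + leg la a y
    col≡ = trans (sym (m+[n∸m]≡n y<col)) (cong (suc y +_) (sym (leg≡col∸ P a y)))

    X : ℕ
    X = s * suc a + r * y

    eastV≡ : eastV a ≡ X + r * (leg la a y + 1)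
    eastV≡ = trans (cong (λ h → s * suc a + r * h) col≡) (east-shape s a r y (leg la a y))

    southV≡ : southV y ≡ X + s * arm la a y
    southV≡ = trans (cong (λ w → s * w + r * y) row≡) (south-shape s a r y (arm la a y))

    row+col≡ : row la y + col la a ≡ suc a + y + hook la a y
    row+col≡ = trans (cong₂ _+_ row≡ col≡) (hook-shape a (arm la a y) y (leg la a y))

    linked⇔critPlusBox : T (linked a y) ⇔ T (critPlusBox a y)
    linked⇔critPlusBox = mk⇔ to from
      where
      residues : eastRes a ≡ southRes y ⇔ c ∣ hook la a y
      residues = residue-≡⇔∣ c {suc a} {col la a} {row la y} {y} row+col≡
      to : T (linked a y) → T (critPlusBox a y)
      to t = ∧-intro (to-∣? (Equivalence.to residues (from-≡ᵇ (∧-elimʳ {eastV a ≡ᵇ southV y} t₂))))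
                     (to-≡ᵇ (+-cancelˡ-≡ X _ _ (trans (sym southV≡) (trans (sym (from-≡ᵇ (∧-elimˡ t₂))) eastV≡))))
        where
        t₂ : T ((eastV a ≡ᵇ southV y) ∧ (eastRes a ≡ᵇ southRes y))
        t₂ = ∧-elimʳ {eastV a <ᵇ suc k} t
      from : T (critPlusBox a y) → T (linked a y)
      from t = ∧-intro (<⇒<ᵇ (s≤s (eastV≤k a (≤-<-trans z≤n y<col))))
                 (∧-intro (to-≡ᵇ (trans eastV≡ (trans (cong (X +_) (sym (from-≡ᵇ (∧-elimʳ {does (c ∣? hook la a y)} t))))
                                                      (sym southV≡))))
                          (to-≡ᵇ (Equivalence.from residues (from-∣? (∧-elimˡ t)))))

  row≤k : ∀ y → y < length la → row la y ≤ suc k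
  row≤k y y<L = ≤-trans (m≤n*m (row la y) s) (≤-trans (m≤m+n _ _) (≤-trans (corner≤ y y<L) (n≤1+n k)))

  length≤k : length la ≤ suc k
  length≤k = ≮⇒≥ (λ k<L → 1+n≰n (≤-trans (n≤1+n (suc k))
    (≤-trans (m≤n*m (suc (suc k)) r) (≤-trans (m≤n+m _ (s * row la (suc k))) (corner≤ (suc k) k<L)))))

  insidePairs≡critPlus : insidePairs ≡ critPlus r s c la
  insidePairs≡critPlus = begin
    insidePairs
      ≡⟨ sumBelow-swap (suc k) (suc k) _ ⟩
    sumBelow (suc k) (λ y → countBelow (suc k) (λ a → (a <ᵇ row la y) ∧ linked a y))
      ≡⟨ sumBelow-pad (length la) (suc k) _ length≤k
           (λ y L≤y _ → countBelow-none (suc k) (λ a _ t → beyond y L≤y (from-<ᵇ (∧-elimˡ t)))) ⟩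
    sumBelow (length la) (λ y → countBelow (suc k) (λ a → (a <ᵇ row la y) ∧ linked a y))
      ≡⟨ sumBelow-cong (length la) (λ y y<L → trans
           (countBelow-pad (row la y) (suc k) _ (row≤k y y<L) (λ a row≤a _ t → <⇒≱ (from-<ᵇ (∧-elimˡ t)) row≤a))
                                                    (countBelow-cong (row la y) (λ a a<row → inBox a<row))) ⟩
    critPlus r s c la ∎
    where
    open ≡-Reasoning
    beyond : ∀ y → length la ≤ y → ∀ {a} → a < row la y → ⊥
    beyond y L≤y a<row = <⇒≱ a<row (subst (_≤ _) (sym (row-beyond la y L≤y)) z≤n)
    inBox : ∀ {a y} → a < row la y → T ((a <ᵇ row la y) ∧ linked a y) ⇔ T (critPlusBox a y)
    inBox {a} {y} a<row = mk⇔ (Equivalence.to (Box.linked⇔critPlusBox a<row) ∘ ∧-elimʳ {a <ᵇ row la y})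
                              (∧-intro (<⇒<ᵇ a<row) ∘ Equivalence.from (Box.linked⇔critPlusBox a<row))

private
  outer-shape : ∀ s r t x y → s * (x + r * t) + r * y ≡ s * x + r * (y + s * t)
  outer-shape = solve-∀
  outer-hook : ∀ x r t y s → x + r * t + (y + s * t) ≡ x + y + (s + r) * t
  outer-hook = solve-∀
  diagonal : ∀ s r t → s * (0 + r * t) + r * 0 ≡ r * s * t
  diagonal = solve-∀
  shift-east : ∀ s x d r h → s * (x + d) + r * h ≡ s * x + r * h + s * d
  shift-east = solve-∀
  shift-south : ∀ s x r h e → s * x + r * (h + e) ≡ s * x + r * h + r * e
  shift-south = solve-∀

  suc-i+α : ∀ i α → suc i + α ≡ i + (α + 1)
  suc-i+α = solve-∀
  hook-rt+st : ∀ α l s r t → α + 1 ≡ r * t → l ≡ s * t → α + l + 1 ≡ (s + r) * t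
  hook-rt+st α l s r t α+1≡ l≡ = trans (shape α l) (trans (cong₂ _+_ α+1≡ l≡) (sum s r t))
    where
    shape : ∀ α l → α + l + 1 ≡ α + 1 + l
    shape = solve-∀
    sum : ∀ s r t → r * t + s * t ≡ (s + r) * t
    sum = solve-∀


module Outside (r s c : ℕ) .{{_ : NonZero c}} (0<r : 0 < r) (0<s : 0 < s) (cop : Coprime r s) (k₁ : ℕ)
               {la : List ℕ} (P : IsPartition la)
               (corner≤ : ∀ j → j < length la → s * row la j + r * suc j ≤ r * s * k₁) where

  k : ℕ
  k = r * s * k₁

  open BoundaryPairs r s c 0<r 0<s P k public
  open Inside r s c 0<r 0<s P k corner≤ public

  admissible : ℕ → Bool
  admissible t = (0 <ᵇ t) ∧ does (c ∣? ((s + r) * t))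

  outerAt : ℕ → ℕ → ℕ → Bool
  outerAt t a y = (suc a ≡ᵇ row la y + r * t) ∧ (y ≡ᵇ col la a + s * t)

  module OuterPair {t a y : ℕ} (a≡ : suc a ≡ row la y + r * t) (y≡ : y ≡ col la a + s * t) where

    eastV≡southV : eastV a ≡ southV y
    eastV≡southV = trans (cong (λ x → s * x + r * col la a) a≡)
                         (trans (outer-shape s r t (row la y) (col la a)) (cong (λ z → s * row la y + r * z) (sym y≡)))

    residues : southRes y ≡ eastRes a ⇔ c ∣ (s + r) * t
    residues = residue-≡⇔∣ c {row la y} {y} {suc a} {col la a}
                 (trans (cong₂ _+_ a≡ y≡) (outer-hook (row la y) r t (col la a) s))

    0<t⇒row≤a : 0 < t → row la y ≤ a
    0<t⇒row≤a 0<t = ≤-pred (subst (row la y <_) (sym a≡) (m<m+n (row la y) (*-pos 0<r 0<t)))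

    row≤a⇒0<t : row la y ≤ a → 0 < t
    row≤a⇒0<t row≤a = n≢0⇒n>0 (λ t≡0 → 1+n≰n (subst (_≤ a) (sym (a≡row t≡0)) row≤a))
      where
      a≡row : t ≡ 0 → suc a ≡ row la y
      a≡row t≡0 = trans a≡ (trans (cong (λ u → row la y + r * u) t≡0) (trans (cong (row la y +_) (*-zeroʳ r)) (+-identityʳ _)))

    eastV≤k⇒t≤k₁ : eastV a ≤ k → t ≤ k₁
    eastV≤k⇒t≤k₁ eastV≤k' = *-cancelˡ-≤ (r * s) {{m*n≢0 r s}} (begin
      r * s * t    ≡⟨ *-assoc r s t ⟩
      r * (s * t)  ≤⟨ *-monoʳ-≤ r (subst (s * t ≤_) (sym y≡) (m≤n+m (s * t) (col la a))) ⟩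
      r * y        ≤⟨ m≤n+m (r * y) (s * row la y) ⟩
      southV y     ≡⟨ eastV≡southV ⟨
      eastV a      ≤⟨ eastV≤k' ⟩
      r * s * k₁   ∎)
      where open ≤-Reasoning

    outerEastV≤k : t ≤ k₁ → eastV a ≤ k
    outerEastV≤k t≤k₁ with col la a ≟ 0 | row la y ≟ 0
    ... | no col≢0 | _ = eastV≤k a (n≢0⇒n>0 col≢0)
    ... | yes _ | no row≢0 = begin
      eastV a                   ≡⟨ eastV≡southV ⟩
      s * row la y + r * y      ≤⟨ +-monoʳ-≤ (s * row la y) (*-monoʳ-≤ r (n≤1+n y)) ⟩
      s * row la y + r * suc y  ≤⟨ corner≤ y (0<row⇒<length la (n≢0⇒n>0 row≢0)) ⟩
      k                         ∎
      where open ≤-Reasoning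
    ... | yes col≡0 | yes row≡0 = begin
      s * suc a + r * col la a  ≡⟨ cong₂ (λ x h → s * x + r * h) (trans a≡ (cong (_+ r * t) row≡0)) col≡0 ⟩
      s * (0 + r * t) + r * 0   ≡⟨ diagonal s r t ⟩
      r * s * t                 ≤⟨ *-monoʳ-≤ (r * s) t≤k₁ ⟩
      k                         ∎
      where open ≤-Reasoning

  outerOffsets : ∀ {a y} → row la y ≤ a → eastV a ≡ southV y →
    Σ ℕ λ t → suc a ≡ row la y + r * t × y ≡ col la a + s * t
  outerOffsets {a} {y} row≤a eastV≡southV = t ,
    trans (sym (m+[n∸m]≡n (m≤n⇒m≤1+n row≤a))) (cong (row la y +_) d≡) ,
    trans (sym (m+[n∸m]≡n col≤y)) (cong (col la a +_) e≡)
    where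
    col≤y : col la a ≤ y
    col≤y = Equivalence.from (col≤⇔row≤ P a y) row≤a
    d e : ℕ
    d = suc a ∸ row la y
    e = y ∸ col la a
    sd≡re : s * d ≡ r * e
    sd≡re = +-cancelˡ-≡ (s * row la y + r * col la a) _ _ (begin
      s * row la y + r * col la a + s * d ≡⟨ shift-east s (row la y) d r (col la a) ⟨
      s * (row la y + d) + r * col la a   ≡⟨ cong (λ x → s * x + r * col la a) (m+[n∸m]≡n (m≤n⇒m≤1+n row≤a)) ⟩
      eastV a                             ≡⟨ eastV≡southV ⟩
      southV y                            ≡⟨ cong (λ z → s * row la y + r * z) (m+[n∸m]≡n col≤y) ⟨
      s * row la y + r * (col la a + e)   ≡⟨ shift-south s (row la y) r (col la a) e ⟩
      s * row la y + r * col la a + r * e ∎)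
      where open ≡-Reasoning
    proportional : Σ ℕ λ t → d ≡ r * t × e ≡ s * t
    proportional = coprime-proportional cop sd≡re
    t : ℕ
    t = proj₁ proportional
    d≡ : d ≡ r * t
    d≡ = proj₁ (proj₂ proportional)
    e≡ : e ≡ s * t
    e≡ = proj₂ (proj₂ proportional)

  outerAt-unique : ∀ {a y} t t' → T (outerAt t a y) → T (outerAt t' a y) → t ≡ t'
  outerAt-unique {a} {y} t t' o o' = *-cancelˡ-≡ t t' r (+-cancelˡ-≡ (row la y) _ _
    (trans (sym (from-≡ᵇ {suc a} (∧-elimˡ o))) (from-≡ᵇ {suc a} (∧-elimˡ o'))))

  outerAt⇒outsideLinked : ∀ {t a y} → t ≤ k₁ → T (admissible t ∧ outerAt t a y) → T (not (a <ᵇ row la y) ∧ linked a y)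
  outerAt⇒outsideLinked {t} {a} {y} t≤k₁ at =
    ∧-intro (not-intro (λ a<row → <⇒≱ (from-<ᵇ a<row) (0<t⇒row≤a (from-<ᵇ (∧-elimˡ adm)))))
            (∧-intro (<⇒<ᵇ (s≤s (outerEastV≤k t≤k₁)))
                     (∧-intro (to-≡ᵇ eastV≡southV) (to-≡ᵇ (sym (Equivalence.from residues (from-∣? (∧-elimʳ {0 <ᵇ t} adm)))))))
    where
    adm : T (admissible t)
    adm = ∧-elimˡ at
    o : T (outerAt t a y)
    o = ∧-elimʳ {admissible t} at
    open OuterPair {t} {a} {y} (from-≡ᵇ (∧-elimˡ o)) (from-≡ᵇ (∧-elimʳ {suc a ≡ᵇ row la y + r * t} o))

  outsideLinked⇒outerAt : ∀ {a y} → T (not (a <ᵇ row la y) ∧ linked a y) →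
    Σ ℕ λ t → t < suc k₁ × T (admissible t ∧ outerAt t a y)
  outsideLinked⇒outerAt {a} {y} o = scale (outerOffsets row≤a (from-≡ᵇ (∧-elimˡ l₂)))
    where
    l : T (linked a y)
    l = ∧-elimʳ {not (a <ᵇ row la y)} o
    l₂ : T ((eastV a ≡ᵇ southV y) ∧ (eastRes a ≡ᵇ southRes y))
    l₂ = ∧-elimʳ {eastV a <ᵇ suc k} l
    row≤a : row la y ≤ a
    row≤a = ≮⇒≥ (not-elim (∧-elimˡ o) ∘ <⇒<ᵇ)
    scale : (Σ ℕ λ t → suc a ≡ row la y + r * t × y ≡ col la a + s * t) →
      Σ ℕ λ t → t < suc k₁ × T (admissible t ∧ outerAt t a y)
    scale (t , a≡ , y≡) = t , s≤s (eastV≤k⇒t≤k₁ (≤-pred (from-<ᵇ (∧-elimˡ l)))) ,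
      ∧-intro (∧-intro (<⇒<ᵇ (row≤a⇒0<t row≤a))
                       (to-∣? (Equivalence.to residues (sym (from-≡ᵇ (∧-elimʳ {eastV a ≡ᵇ southV y} l₂))))))
              (∧-intro (to-≡ᵇ a≡) (to-≡ᵇ y≡))
      where open OuterPair a≡ y≡

  outsideLinked≡count : ∀ a y → ⟦ not (a <ᵇ row la y) ∧ linked a y ⟧ ≡ countBelow (suc k₁) (λ t → admissible t ∧ outerAt t a y)
  outsideLinked≡count a y = ⟦⟧≡countBelow-unique (suc k₁) _ outsideLinked⇒outerAt
    (λ t t<k₁ → outerAt⇒outsideLinked (≤-pred t<k₁))
    (λ t t' at at' → outerAt-unique t t' (∧-elimʳ {admissible t} at) (∧-elimʳ {admissible t'} at'))

  module Scaled {t : ℕ} (0<t : 0 < t) where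

    p q : ℕ
    p = pred (r * t)
    q = pred (s * t)

    r*t≡ : r * t ≡ suc p
    r*t≡ = sym (suc-pred (r * t) {{>-nonZero (*-pos 0<r 0<t)}})

    s*t≡ : s * t ≡ suc q
    s*t≡ = sym (suc-pred (s * t) {{>-nonZero (*-pos 0<s 0<t)}})

    x : ℕ → ℕ
    x y = row la y + p

    x≡ : ∀ y → suc (x y) ≡ row la y + r * t
    x≡ y = trans (sym (+-suc (row la y) p)) (cong (row la y +_) (sym r*t≡))

    outerAt⇔ : ∀ a y → T (outerAt t a y) ⇔ T ((a ≡ᵇ x y) ∧ (y ≡ᵇ col la (x y) + suc q))
    outerAt⇔ a y = mk⇔
      (λ o → let a≡x = suc-injective (trans (from-≡ᵇ {suc a} (∧-elimˡ o)) (sym (x≡ y))) in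
        ∧-intro (to-≡ᵇ a≡x)
                (to-≡ᵇ (trans (from-≡ᵇ {y} (∧-elimʳ {suc a ≡ᵇ row la y + r * t} o)) (cong₂ _+_ (cong (col la) a≡x) s*t≡))))
      (λ o → let a≡x = from-≡ᵇ {a} (∧-elimˡ o) in
        ∧-intro (to-≡ᵇ (trans (cong suc a≡x) (x≡ y)))
                (to-≡ᵇ (trans (from-≡ᵇ {y} (∧-elimʳ {a ≡ᵇ x y} o)) (cong₂ _+_ (cong (col la) (sym a≡x)) (sym s*t≡)))))

  outerCount : ℕ → ℕ
  outerCount t = sumBelow (suc k) (λ a → countBelow (suc k) (outerAt t a))

  outerCount≡outerPairs : ∀ t → 0 < t → t ≤ k₁ → outerCount t ≡ outerPairs la (pred (r * t)) (pred (s * t))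
  outerCount≡outerPairs t 0<t t≤k₁ = begin
    outerCount t
      ≡⟨ sumBelow-swap (suc k) (suc k) _ ⟩
    sumBelow (suc k) (λ y → countBelow (suc k) (λ a → outerAt t a y))
      ≡⟨ sumBelow-cong (suc k) (λ y _ → trans (countBelow-cong (suc k) (λ a _ → outerAt⇔ a y)) (countBelow-at (suc k) (x y) _)) ⟩
    countBelow (suc k) (λ y → (x y <ᵇ suc k) ∧ (y ≡ᵇ col la (x y) + suc q))
      ≡⟨ countBelow-bounded-cong (suc k) (length la + suc (suc q))
           (λ y → mk⇔ (λ o → to-≡ᵇ (sym (from-≡ᵇ {y} (∧-elimʳ {x y <ᵇ suc k} o))))
                      (λ o → let y≡ = sym (from-≡ᵇ {col la (x y) + suc q} o) in ∧-intro (<⇒<ᵇ (x<k y≡)) (to-≡ᵇ y≡)))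
           (λ y o → y<k (from-≡ᵇ {y} (∧-elimʳ {x y <ᵇ suc k} o)))
           (λ y o → y<length (sym (from-≡ᵇ {col la (x y) + suc q} o))) ⟩
    outerPairs la p q ∎
    where
    open ≡-Reasoning
    open Scaled 0<t
    module Outer {y} (y≡ : y ≡ col la (x y) + suc q) =
      OuterPair {t} {x y} {y} (x≡ y) (trans y≡ (cong (col la (x y) +_) (sym s*t≡)))
    x<k : ∀ {y} → y ≡ col la (x y) + suc q → x y < suc k
    x<k {y} y≡ = s≤s (≤-trans (n≤1+n (x y)) (≤-trans (m≤n*m (suc (x y)) s)
                   (≤-trans (m≤m+n _ _) (Outer.outerEastV≤k y≡ t≤k₁))))
    y<k : ∀ {y} → y ≡ col la (x y) + suc q → y < suc k
    y<k {y} y≡ = s≤s (≤-trans (m≤n*m y r) (≤-trans (m≤n+m _ _)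
                   (≤-trans (≤-reflexive (sym (Outer.eastV≡southV y≡))) (Outer.outerEastV≤k y≡ t≤k₁))))
    y<length : ∀ {y} → y ≡ col la (x y) + suc q → y < length la + suc (suc q)
    y<length {y} y≡ = ≤-trans (s≤s (≤-trans (≤-reflexive y≡) (+-monoˡ-≤ (suc q) (col≤length P (x y)))))
                              (≤-reflexive (sym (+-suc (length la) (suc q))))

  -- Boxes with arm + 1 = r t and leg = s t, when 0 < t.
  armLegCount : ℕ → ℕ
  armLegCount t = armLegBoxes la (pred (r * t)) (pred (s * t))

  outsidePairs≡ : outsidePairs ≡ sumBelow (suc k₁) (λ t → ⟦ admissible t ⟧ * suc (armLegCount t))
  outsidePairs≡ = begin
    outsidePairs
      ≡⟨ sumBelow-cong (suc k) (λ a _ → sumBelow-cong (suc k) (λ y _ → outsideLinked≡count a y)) ⟩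
    sumBelow (suc k) (λ a → sumBelow (suc k) (λ y → countBelow (suc k₁) (λ t → admissible t ∧ outerAt t a y)))
      ≡⟨ sumBelow-sumBelow-countBelow-∧ (suc k) (λ _ → suc k) (suc k₁) admissible outerAt ⟩
    sumBelow (suc k₁) (λ t → ⟦ admissible t ⟧ * outerCount t)
      ≡⟨ sumBelow-cong (suc k₁) (λ t t<k₁ → ⟦⟧*-cong (admissible t) (λ adm →
           trans (outerCount≡outerPairs t (from-<ᵇ (∧-elimˡ adm)) (≤-pred t<k₁)) (outerPairs≡1+armLegBoxes P _ _))) ⟩
    sumBelow (suc k₁) (λ t → ⟦ admissible t ⟧ * suc (armLegCount t)) ∎
    where open ≡-Reasoning

  critMinusBox : ℕ → ℕ → Bool
  critMinusBox i j = does (c ∣? hook la i j) ∧ ((0 <ᵇ leg la i j) ∧ (s * (arm la i j + 1) ≡ᵇ r * leg la i j))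

  armLegRow : ℕ → ℕ → Bool
  armLegRow t j = (r * t ≤ᵇ row la j) ∧ (col la (row la j ∸ r * t) ≡ᵇ suc (j + s * t))

  boxAt : ℕ → ℕ → ℕ → Bool
  boxAt t i j = (i ≡ᵇ row la j ∸ r * t) ∧ armLegRow t j

  boxAt⇒i+rt≡row : ∀ {t i j} → T (boxAt t i j) → i + r * t ≡ row la j
  boxAt⇒i+rt≡row {t} {i} {j} b = trans (cong (_+ r * t) (from-≡ᵇ {i} (∧-elimˡ b)))
    (m∸n+n≡m (from-≤ᵇ {r * t} (∧-elimˡ (∧-elimʳ {i ≡ᵇ row la j ∸ r * t} b))))

  boxAt-unique : ∀ {i j} t t' → T (boxAt t i j) → T (boxAt t' i j) → t ≡ t'
  boxAt-unique {i} t t' b b' = *-cancelˡ-≡ t t' r (+-cancelˡ-≡ i _ _ (trans (boxAt⇒i+rt≡row {t} b) (sym (boxAt⇒i+rt≡row {t'} b'))))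

  module MinusBox {i j : ℕ} (i<row : i < row la j) where

    row≡ : row la j ≡ i + (arm la i j + 1)
    row≡ = trans (Box.row≡ i<row) (suc-i+α i (arm la i j))

    boxAt⇒critMinusBox : ∀ t → T (admissible t ∧ boxAt t i j) → T (critMinusBox i j)
    boxAt⇒critMinusBox t ab = ∧-intro (to-∣? (subst (c ∣_) (sym hook≡) (from-∣? (∧-elimʳ {0 <ᵇ t} adm))))
      (∧-intro (<⇒<ᵇ (subst (0 <_) (sym leg≡) (*-pos 0<s 0<t)))
               (to-≡ᵇ (trans (cong (s *_) arm+1≡) (trans (s*[r*t] s r t) (cong (r *_) (sym leg≡))))))
      where
      adm : T (admissible t)
      adm = ∧-elimˡ ab
      b : T (boxAt t i j)
      b = ∧-elimʳ {admissible t} ab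
      0<t : 0 < t
      0<t = from-<ᵇ (∧-elimˡ adm)
      arm+1≡ : arm la i j + 1 ≡ r * t
      arm+1≡ = +-cancelˡ-≡ i _ _ (trans (sym row≡) (sym (boxAt⇒i+rt≡row b)))
      leg≡ : leg la i j ≡ s * t
      leg≡ = +-cancelˡ-≡ (suc j) _ _ (trans (sym (Box.col≡ i<row)) (trans (cong (col la) (from-≡ᵇ {i} (∧-elimˡ b)))
               (from-≡ᵇ (∧-elimʳ {r * t ≤ᵇ row la j} (∧-elimʳ {i ≡ᵇ row la j ∸ r * t} b)))))
      hook≡ : hook la i j ≡ (s + r) * t
      hook≡ = hook-rt+st (arm la i j) (leg la i j) s r t arm+1≡ leg≡
      s*[r*t] : ∀ s r t → s * (r * t) ≡ r * (s * t)
      s*[r*t] = solve-∀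

    critMinusBox⇒boxAt : T (critMinusBox i j) → Σ ℕ λ t → t < suc k₁ × T (admissible t ∧ boxAt t i j)
    critMinusBox⇒boxAt cm = t , s≤s t≤k₁ ,
      ∧-intro (∧-intro (<⇒<ᵇ 0<t) (to-∣? (subst (c ∣_) hook≡ (from-∣? (∧-elimˡ cm)))))
              (∧-intro (to-≡ᵇ i≡) (∧-intro (≤⇒≤ᵇ (subst (r * t ≤_) i+rt≡row (m≤n+m (r * t) i)))
                                            (to-≡ᵇ (trans (cong (col la) (sym i≡)) (trans (Box.col≡ i<row) (cong (suc j +_) leg≡))))))
      where
      cm₂ : T ((0 <ᵇ leg la i j) ∧ (s * (arm la i j + 1) ≡ᵇ r * leg la i j))
      cm₂ = ∧-elimʳ {does (c ∣? hook la i j)} cm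
      proportional : Σ ℕ λ t → arm la i j + 1 ≡ r * t × leg la i j ≡ s * t
      proportional = coprime-proportional cop (from-≡ᵇ (∧-elimʳ {0 <ᵇ leg la i j} cm₂))
      t : ℕ
      t = proj₁ proportional
      arm+1≡ : arm la i j + 1 ≡ r * t
      arm+1≡ = proj₁ (proj₂ proportional)
      leg≡ : leg la i j ≡ s * t
      leg≡ = proj₂ (proj₂ proportional)
      hook≡ : hook la i j ≡ (s + r) * t
      hook≡ = hook-rt+st (arm la i j) (leg la i j) s r t arm+1≡ leg≡
      0<t : 0 < t
      0<t = n≢0⇒n>0 (λ t≡0 → 1+n≢0 (trans (+-comm 1 (arm la i j)) (trans arm+1≡ (trans (cong (r *_) t≡0) (*-zeroʳ r)))))
      i+rt≡row : i + r * t ≡ row la j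
      i+rt≡row = trans (cong (i +_) (sym arm+1≡)) (sym row≡)
      i≡ : i ≡ row la j ∸ r * t
      i≡ = trans (sym (m+n∸n≡m i (r * t))) (cong (_∸ r * t) i+rt≡row)
      t≤k₁ : t ≤ k₁
      t≤k₁ = *-cancelˡ-≤ (r * s) {{m*n≢0 r s}} (begin
        r * s * t         ≡⟨ *-assoc r s t ⟩
        r * (s * t)       ≡⟨ cong (r *_) leg≡ ⟨
        r * leg la i j    ≤⟨ *-monoʳ-≤ r (subst (leg la i j ≤_) (sym (Box.col≡ i<row)) (m≤n+m (leg la i j) (suc j))) ⟩
        r * col la i      ≤⟨ m≤n+m (r * col la i) (s * suc i) ⟩
        eastV i           ≤⟨ eastV≤k i (≤-<-trans z≤n (Box.y<col i<row)) ⟩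
        r * s * k₁        ∎)
        where open ≤-Reasoning

  critMinusBox≡count : ∀ {i j} → i < row la j → ⟦ critMinusBox i j ⟧ ≡ countBelow (suc k₁) (λ t → admissible t ∧ boxAt t i j)
  critMinusBox≡count {i} {j} i<row = ⟦⟧≡countBelow-unique (suc k₁) _ (MinusBox.critMinusBox⇒boxAt i<row)
    (λ t _ → MinusBox.boxAt⇒critMinusBox i<row t)
    (λ t t' ab ab' → boxAt-unique {i} {j} t t' (∧-elimʳ {admissible t} ab) (∧-elimʳ {admissible t'} ab'))

  boxAtCount≡armLegCount : ∀ t → 0 < t →
    sumBelow (length la) (λ j → countBelow (row la j) (λ i → boxAt t i j)) ≡ armLegCount t
  boxAtCount≡armLegCount t 0<t = sumBelow-cong (length la) (λ j _ → trans
    (countBelow-at-< (row la j) (row la j ∸ r * t) (λ _ → armLegRow t j) (corner< j))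
    (cong ⟦_⟧ (cong₂ (λ u w → (u ≤ᵇ row la j) ∧ (col la (row la j ∸ u) ≡ᵇ suc (j + w))) r*t≡ s*t≡)))
    where
    open Scaled 0<t
    corner< : ∀ j → T (armLegRow t j) → row la j ∸ r * t < row la j
    corner< j a = subst (λ u → row la j ∸ u < row la j) (sym r*t≡)
                        (∸suc< (subst (_≤ row la j) r*t≡ (from-≤ᵇ {r * t} (∧-elimˡ a))))

  critMinus≡ : critMinus r s c la ≡ sumBelow (suc k₁) (λ t → ⟦ admissible t ⟧ * armLegCount t)
  critMinus≡ = begin
    critMinus r s c la
      ≡⟨ sumBelow-cong (length la) (λ j _ → sumBelow-cong (row la j) (λ i i<row → critMinusBox≡count i<row)) ⟩
    sumBelow (length la) (λ j → sumBelow (row la j) (λ i → countBelow (suc k₁) (λ t → admissible t ∧ boxAt t i j)))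
      ≡⟨ sumBelow-sumBelow-countBelow-∧ (length la) (row la) (suc k₁) admissible (λ t j i → boxAt t i j) ⟩
    sumBelow (suc k₁) (λ t → ⟦ admissible t ⟧ * sumBelow (length la) (λ j → countBelow (row la j) (λ i → boxAt t i j)))
      ≡⟨ sumBelow-cong (suc k₁) (λ t _ → ⟦⟧*-cong (admissible t) (boxAtCount≡armLegCount t ∘ from-<ᵇ ∘ ∧-elimˡ)) ⟩
    sumBelow (suc k₁) (λ t → ⟦ admissible t ⟧ * armLegCount t) ∎
    where open ≡-Reasoning

  outsidePairs≡floor+critMinus : outsidePairs ≡ floorDiv (k₁ * (s + r)) (lcm c (s + r)) + critMinus r s c la
  outsidePairs≡floor+critMinus = begin
    outsidePairs
      ≡⟨ outsidePairs≡ ⟩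
    sumBelow (suc k₁) (λ t → ⟦ admissible t ⟧ * suc (armLegCount t))
      ≡⟨ sumBelow-cong (suc k₁) (λ t _ → *-suc ⟦ admissible t ⟧ (armLegCount t)) ⟩
    sumBelow (suc k₁) (λ t → ⟦ admissible t ⟧ + ⟦ admissible t ⟧ * armLegCount t)
      ≡⟨ sumBelow-+ (suc k₁) _ _ ⟩
    countBelow (suc k₁) admissible + sumBelow (suc k₁) (λ t → ⟦ admissible t ⟧ * armLegCount t)
      ≡⟨ cong₂ _+_ (count-c∣n*t≡floorDiv c (s + r) k₁) (sym critMinus≡) ⟩
    floorDiv (k₁ * (s + r)) (lcm c (s + r)) + critMinus r s c la ∎
    where
    open ≡-Reasoning
    instance
      s+r-nonZero : NonZero (s + r)
      s+r-nonZero = >-nonZero (<-≤-trans 0<s (m≤m+n s r))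

proposition6p7 : (r s c k₁ : ℕ) .{{_ : NonZero c}} →
    0 < r → 0 < s → Coprime r s → 0 < k₁ → c ∣ k₁ →
    (la : List ℕ) → IsPartition la →
    PartLt r s c la (lambdaRSK r s (r * s * k₁)) →
    critPlus r s c la + critMinus r s c la
      + floorDiv (k₁ * (s + r)) (lcm c (s + r))
      ≡ edgeSum r s c la (r * s * k₁)
proposition6p7 r s c k₁ 0<r 0<s cop _ _ la P la<λ = begin
  critPlus r s c la + critMinus r s c la + ⌊k₁[s+r]/lcm⌋ ≡⟨ +-assoc (critPlus r s c la) _ _ ⟩
  critPlus r s c la + (critMinus r s c la + ⌊k₁[s+r]/lcm⌋) ≡⟨ cong (critPlus r s c la +_) (+-comm _ ⌊k₁[s+r]/lcm⌋) ⟩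
  critPlus r s c la + (⌊k₁[s+r]/lcm⌋ + critMinus r s c la)
    ≡⟨ cong₂ _+_ insidePairs≡critPlus outsidePairs≡floor+critMinus ⟨
  insidePairs + outsidePairs ≡⟨ linkedPairs≡inside+outside ⟨
  linkedPairs                ≡⟨ edgeSum≡linkedPairs ⟨
  edgeSum r s c la (r * s * k₁) ∎
  where
  open ≡-Reasoning
  open Outside r s c 0<r 0<s cop k₁ P (PartLt-lambdaRSK⇒corner≤ {r} {s} {c} {r * s * k₁} P la<λ)
  ⌊k₁[s+r]/lcm⌋ = floorDiv (k₁ * (s + r)) (lcm c (s + r))
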